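{- Let $p$ be a prime with $p \equiv 1 \pmod 6$. Then for every integer $e \ge 1$ there is, up to isomorphism, a unique 6-valent first-kind Frobenius circulant of order $p^e$ (with cyclic kernel), namely $\Gamma(p^e) = TL_{p^e}(a_e, a_e - 1, 1)$, where $a_e \equiv (p^e+1)(v+1)/2 \pmod{p^e}$ with $v$ a solution of $x^2 \equiv -3 \pmod{p^e}$.
   Context: For integers $1 \le a,b,c \le N-1$ with $a,b,c,N-a,N-b,N-c$ pairwise distinct, $TL_N(a,b,c)$ is the Cayley graph on $\mathbb{Z}_N$ with connection set $\{\pm[a],\pm[b],\pm[c]\}$ (vertices $x,y$ adjacent iff $x-y$ lies in the set). A transitive permutation group $G$ on a finite set is a Frobenius group if it is not regular and only the identity fixes two points; then $G = K\rtimes H$ with Frobenius kernel $K$ regular and normal and $H$ a point stabiliser acting on $K$ by conjugation. A first-kind $G$-Frobenius graph is $\mathrm{Cay}(K,a^H)$ with $\langle a^H\rangle = K$ and $|H|$ even or $a$ an involution. A 6-valent first-kind Frobenius circulant of order $N$ with cyclic kernel is such a 6-valent graph where the kernel $K$ is cyclic of order $N$. -}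

module Defs where

open import Data.Nat as ℕ using (ℕ; zero; suc; _≤_; _<_; ⌊_/2⌋)
open import Data.Integer as ℤ using (ℤ; +_; -_; _-_; _*_)
open import Data.Integer.Divisibility using (_∣_)
open import Data.Fin using (Fin; toℕ)
open import Data.List using (List; []; _∷_; map; length)
open import Data.List.Membership.Propositional using (_∈_)
open import Data.List.Relation.Unary.Unique.Propositional using (Unique)
open import Data.List.Relation.Unary.AllPairs using (AllPairs)
open import Data.Product using (Σ; ∃; ∃-syntax; _×_)
open import Data.Sum using (_⊎_)
open import Relation.Nullary using (¬_)
open import Relation.Binary.PropositionalEquality using (_≡_)
open import Function.Bundles using (_⇔_; _↔_; Inverse)

-- Arithmetic in ℤ_N, with residues represented by integers.

infix 4 _≡_[mod_]
_≡_[mod_] : ℤ → ℤ → ℕ → Set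
x ≡ y [mod N ] = (+ N) ∣ (x - y)

ι : {N : ℕ} → Fin N → ℤ
ι x = + toℕ x

DistinctMod : ℕ → List ℤ → Set
DistinctMod N = AllPairs (λ x y → ¬ (x ≡ y [mod N ]))

-- Graphs on the vertex set ℤ_N = Fin N (adjacency relations).

Graph : ℕ → Set₁
Graph N = Fin N → Fin N → Set

Cay : (N : ℕ) → List ℤ → Graph N
Cay N S x y = ∃[ s ] (s ∈ S × (ι x - ι y) ≡ s [mod N ])

TL : (N : ℕ) → ℤ → ℤ → ℤ → Graph N
TL N a b c = Cay N (a ∷ - a ∷ b ∷ - b ∷ c ∷ - c ∷ [])

TLValid : ℕ → ℤ → ℤ → ℤ → Set
TLValid N a b c =
  (All3 (λ t → (+ 1) ℤ.≤ t × t ℤ.≤ (+ N) - (+ 1)))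
  × Unique (a ∷ b ∷ c ∷ (+ N) - a ∷ (+ N) - b ∷ (+ N) - c ∷ [])
  where
  All3 : (ℤ → Set) → Set
  All3 P = P a × P b × P c

_≅_ : {N : ℕ} → Graph N → Graph N → Set
_≅_ {N} Γ Δ = Σ (Fin N ↔ Fin N) λ f →
  ∀ x y → Γ x y ⇔ Δ (Inverse.to f x) (Inverse.to f y)

Valent : {N : ℕ} → ℕ → Graph N → Set
Valent {N} k Γ = ∀ x → ∃[ ys ]
  (length ys ≡ k × Unique ys × (∀ y → Γ x y ⇔ (y ∈ ys)))

-- The complement H (a point stabiliser, acting on K by conjugation) is a
-- group of automorphisms of ℤ_N, i.e. a set of units mod N acting by
-- multiplication; G = { x ↦ h x + k : h ∈ H, k ∈ ℤ_N }.

data Gen (N : ℕ) (S : List ℤ) : ℤ → Set where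
  gen  : ∀ {s} → s ∈ S → Gen N S s
  zero : Gen N S (+ 0)
  sub  : ∀ {x y} → Gen N S x → Gen N S y → Gen N S (x - y)
  mod  : ∀ {x y} → Gen N S x → x ≡ y [mod N ] → Gen N S y

IsAutSubgroup : ℕ → List ℤ → Set
IsAutSubgroup N H =
    DistinctMod N H
  × (+ 1) ∈ H
  × (∀ {h} → h ∈ H → ∃[ u ] (h * u ≡ (+ 1) [mod N ]))
  × (∀ {h h′} → h ∈ H → h′ ∈ H → ∃[ h″ ] (h″ ∈ H × h * h′ ≡ h″ [mod N ]))

-- G = ℤ_N ⋊ H acting on ℤ_N by x ↦ h x + k is a Frobenius group:
-- not regular (some non-identity element fixes a point), and only the
-- identity fixes two distinct points.
IsFrobenius : ℕ → List ℤ → Set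
IsFrobenius N H =
    (∃[ h ] (h ∈ H × ¬ (h ≡ (+ 1) [mod N ])))
  × (∀ {h} k x y → h ∈ H
       → (h * x) ℤ.+ k ≡ x [mod N ]
       → (h * y) ℤ.+ k ≡ y [mod N ]
       → ¬ (x ≡ y [mod N ])
       → (h ≡ (+ 1) [mod N ] × k ≡ (+ 0) [mod N ]))

FrobCirc6 : (N : ℕ) → Graph N → Set
FrobCirc6 N Γ = ∃[ H ] ∃[ a ]
    IsAutSubgroup N H
  × IsFrobenius N H
  × (∀ x → Gen N (map (λ h → h * a) H) x)
  × ((∃[ m ] (length H ≡ 2 ℕ.* m))
     ⊎ (¬ (a ≡ (+ 0) [mod N ]) × (+ 2) * a ≡ (+ 0) [mod N ]))
  × (∀ x y → Γ x y ⇔ Cay N (map (λ h → h * a) H) x y)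
  × Valent 6 Γ

module Submission where

-- (1) -3 is a square modulo N: by Fermat's little theorem and the bound on
--     the number of roots of a polynomial, p has a primitive cube root of
--     unity x; then (2x + 1)² ≡ -3, and Hensel's lemma lifts this to N.
-- (2) a is a root of x² - x + 1, i.e. a primitive sixth root of unity; its
--     powers ±1, ±a, ±(a - 1) pairwise differ by units, so they form the
--     complement of a Frobenius group ℤ_N ⋊ H with TL_N(a, a-1, 1) = Cay(ℤ_N, H).
-- (3) For any such circulant Cay(ℤ_N, b^K), b is a unit and |K| = 6, so by
--     Lagrange's argument every k ∈ K is a root of x⁶ - 1 = ∏_{h ∈ H} (x - h);
--     the factors are pairwise prime to p, hence K = H modulo N, and
--     multiplication by b⁻¹ is an isomorphism onto TL_N(a, a - 1, 1).

open import Defs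
open import Data.Nat using (ℕ; _≤_; _<_; _%_; _^_; ⌊_/2⌋)
open import Data.Nat.Primality using (Prime)
open import Data.Integer using (ℤ; +_; -_; _-_; _*_)
open import Data.Product using (∃-syntax; _×_)
open import Relation.Binary.PropositionalEquality using (_≡_)

open import Data.Nat as ℕ using (zero; suc; z≤n; s≤s; NonZero)
import Data.Nat.Properties as ℕP
import Data.Nat.Divisibility as ℕD
import Data.Nat.DivMod as ℕDM
open import Data.Nat.ListAction using (product)
open import Data.Nat.ListAction.Properties using (product-↭)
open import Data.Nat.Primality using (euclidsLemma; prime⇒nonZero; prime⇒nonTrivial)
open import Data.Nat.Tactic.RingSolver using () renaming (solve-∀ to ℕ-solve-∀)
open import Data.Integer as ℤ using (_+_; ∣_∣; _%ℕ_; _/ℕ_)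
import Data.Integer.Properties as ℤP
import Data.Integer.DivMod as ℤDM
import Data.Integer.Divisibility as ℤD
open import Data.Integer.Divisibility.Signed as Signed
  using (_∣_; divides; quotient; ∣ᵤ⇒∣; ∣⇒∣ᵤ; ∣-refl; ∣m∣n⇒∣m+n; ∣n⇒∣m*n)
open import Data.Integer.Tactic.RingSolver using (solve; solve-∀)
open import Data.Fin using (Fin; toℕ; fromℕ<)
import Data.Fin.Properties as FinP
open import Data.List using (List; []; _∷_; length; map; foldr; applyUpTo)
open import Data.List.Properties using (length-map; length-applyUpTo; map-cong; map-id)
open import Data.List.Membership.Propositional using (_∈_; _∉_; find)
open import Data.List.Membership.Propositional.Properties
  using (∈-map⁺; ∈-map⁻; ∈-applyUpTo⁺; ∈-applyUpTo⁻)
open import Data.List.Membership.Propositional.Properties.WithK using (unique∧set⇒bag)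
open import Data.List.Relation.Unary.Any using (Any; here; there)
import Data.List.Relation.Unary.Any.Properties as AnyP
open import Data.List.Relation.Unary.All as All using (All)
import Data.List.Relation.Unary.All.Properties as All
open import Data.List.Relation.Unary.AllPairs as AllPairs using (AllPairs)
import Data.List.Relation.Unary.AllPairs.Properties as AllPairs
open import Data.List.Relation.Unary.Unique.Propositional using (Unique)
import Data.List.Relation.Unary.Unique.DecPropositional as DecUnique
open import Data.List.Relation.Binary.Subset.Propositional using (_⊆_)
open import Data.List.Relation.Binary.Permutation.Propositional using (_↭_)
open import Data.List.Relation.Binary.BagAndSetEquality using (∼bag⇒↭)
open import Data.List.Relation.Binary.Pointwise as Pointwise using (Pointwise)
open import Data.Product using (_,_; proj₁; proj₂)
open import Data.Sum using (_⊎_; inj₁; inj₂; [_,_]′)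
open import Function using (_∘_; id)
open import Function.Bundles using (_⇔_; mk⇔; Equivalence; mk↔ₛ′)
open import Function.Properties.Equivalence using () renaming (sym to ⇔-sym)
open import Relation.Binary.Bundles using (Setoid)
open import Relation.Binary.Structures using (IsEquivalence)
open import Relation.Binary.Definitions using (DecidableEquality; _Respects₂_; tri<; tri≈; tri>)
import Relation.Binary.Reasoning.Setoid
open import Relation.Binary.PropositionalEquality
  using (_≢_; refl; sym; trans; cong; cong₂; subst; subst₂; module ≡-Reasoning)
open import Relation.Nullary using (¬_; yes; no; Dec)
open import Relation.Nullary.Decidable using (from-yes; map′)
open import Relation.Nullary.Negation using (contradiction)

module Counting {A : Set} (_≟_ : DecidableEquality A) where
  open import Data.List.Membership.DecPropositional _≟_ using (_∈?_)

  remove : ∀ {x} (ys : List A) → x ∈ ys → List A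
  remove (_ ∷ ys) (here _)  = ys
  remove (y ∷ ys) (there p) = y ∷ remove ys p

  length-remove : ∀ {x} (ys : List A) (p : x ∈ ys) → length ys ≡ suc (length (remove ys p))
  length-remove (_ ∷ ys) (here _)  = refl
  length-remove (y ∷ ys) (there p) = cong suc (length-remove ys p)

  ∈-remove : ∀ {x z} (ys : List A) (p : x ∈ ys) → z ∈ ys → z ≢ x → z ∈ remove ys p
  ∈-remove (_ ∷ ys) (here refl) (here refl) z≢x = contradiction refl z≢x
  ∈-remove (_ ∷ ys) (here refl) (there q)   z≢x = q
  ∈-remove (_ ∷ ys) (there p)   (here refl) z≢x = here refl
  ∈-remove (_ ∷ ys) (there p)   (there q)   z≢x = there (∈-remove ys p q z≢x)

  unique-⊆⇒length≤ : ∀ {xs ys : List A} → Unique xs → xs ⊆ ys → length xs ≤ length ys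
  unique-⊆⇒length≤ {[]}     _            _  = z≤n
  unique-⊆⇒length≤ {x ∷ xs} {ys} (x∉xs AllPairs.∷ u) xs⊆ys =
    subst (suc (length xs) ≤_) (sym (length-remove ys x∈ys))
      (s≤s (unique-⊆⇒length≤ u (λ z∈xs →
        ∈-remove ys x∈ys (xs⊆ys (there z∈xs)) (λ { refl → All.lookup x∉xs z∈xs refl }))))
    where x∈ys = xs⊆ys (here refl)

  unique-⊆-length≥⇒⊇ : ∀ {xs ys : List A} → Unique xs → length ys ≤ length xs → xs ⊆ ys → ys ⊆ xs
  unique-⊆-length≥⇒⊇ {xs} {ys} u ys≤xs xs⊆ys {y} y∈ys with y ∈? xs
  ... | yes y∈xs = y∈xs
  ... | no  y∉xs = contradiction
      (ℕP.≤-trans (unique-⊆⇒length≤ (y∉⇒All y∉xs AllPairs.∷ u) y∷xs⊆ys) ys≤xs) (ℕP.<-irrefl refl)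
    where
    y∉⇒All : ∀ {zs} → y ∉ zs → All (y ≢_) zs
    y∉⇒All {[]}     _  = All.[]
    y∉⇒All {z ∷ zs} y∉ = (λ y≡z → y∉ (here y≡z)) All.∷ y∉⇒All (λ y∈ → y∉ (there y∈))
    y∷xs⊆ys : (y ∷ xs) ⊆ ys
    y∷xs⊆ys (here refl) = y∈ys
    y∷xs⊆ys (there z∈)  = xs⊆ys z∈

  same-members⇒↭ : ∀ {xs ys : List A} → Unique xs → Unique ys → xs ⊆ ys → ys ⊆ xs → xs ↭ ys
  same-members⇒↭ {xs} {ys} u u′ xs⊆ys ys⊆xs =
    ∼bag⇒↭ (unique∧set⇒bag {xs = xs} {ys = ys} u u′ (λ {x} → mk⇔ (xs⊆ys {x}) (ys⊆xs {x})))

  same-members⇒length≡ : ∀ {xs ys : List A} → Unique xs → Unique ys → xs ⊆ ys → ys ⊆ xs →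
                         length xs ≡ length ys
  same-members⇒length≡ u u′ xs⊆ys ys⊆xs =
    ℕP.≤-antisym (unique-⊆⇒length≤ u xs⊆ys) (unique-⊆⇒length≤ u′ ys⊆xs)

-- Congruence modulo M.  It is the relation _≡_[mod_] of Defs, wrapped in
-- a record so that both sides can be inferred from the type.
module Congruence (M : ℕ) where

  infix 4 _≋_
  record _≋_ (x y : ℤ) : Set where
    constructor mk≋
    field unwrap : x ≡ y [mod M ]
  open _≋_ public

  ≋⇒∣ : ∀ {x y} → x ≋ y → + M ∣ x - y
  ≋⇒∣ (mk≋ d) = ∣ᵤ⇒∣ d

  ∣⇒≋ : ∀ {x y} → + M ∣ x - y → x ≋ y
  ∣⇒≋ d = mk≋ (∣⇒∣ᵤ d)

  ≋0⇒∣∣ : ∀ {z} → z ≋ + 0 → M ℕD.∣ ∣ z ∣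
  ≋0⇒∣∣ {z} (mk≋ M∣z-0) = subst (λ w → M ℕD.∣ ∣ w ∣) (ℤP.+-identityʳ z) M∣z-0

  ∣∣⇒≋0 : ∀ {z} → M ℕD.∣ ∣ z ∣ → z ≋ + 0
  ∣∣⇒≋0 {z} M∣z = mk≋ (subst (λ w → M ℕD.∣ ∣ w ∣) (sym (ℤP.+-identityʳ z)) M∣z)

  -- x ≡ y modulo M as soon as x - y is an integral combination of two
  -- quantities known to vanish modulo M; every congruence rule below is
  -- an instance, with the combination found by the ring solver.
  combine : ∀ {x y z₁ z₂} (a b : ℤ) → z₁ ≋ + 0 → z₂ ≋ + 0 →
            x - y ≡ a * z₁ + b * z₂ → x ≋ y
  combine {z₁ = z₁} {z₂} a b p q eq = ∣⇒≋ (subst (+ M ∣_) (sym eq)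
    (∣m∣n⇒∣m+n (∣n⇒∣m*n a (vanishes p)) (∣n⇒∣m*n b (vanishes q))))
    where
    vanishes : ∀ {z} → z ≋ + 0 → + M ∣ z
    vanishes {z} r = subst (+ M ∣_) (ℤP.+-identityʳ z) (≋⇒∣ r)

  ≋-by : ∀ {x y z} (k : ℤ) → z ≋ + 0 → x - y ≡ k * z → x ≋ y
  ≋-by {x} {y} {z} k p eq = combine k (+ 0) p p (trans eq (solve (k ∷ z ∷ [])))

  diff≋0 : ∀ {x y} → x ≋ y → x - y ≋ + 0
  diff≋0 {x} {y} p = ∣⇒≋ (subst (+ M ∣_) (sym (ℤP.+-identityʳ (x - y))) (≋⇒∣ p))

  diff≋0⁻¹ : ∀ {x y} → x - y ≋ + 0 → x ≋ y
  diff≋0⁻¹ {x} {y} p = ≋-by (+ 1) p (sym (ℤP.*-identityˡ (x - y)))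

  ≋-reflexive : ∀ {x y} → x ≡ y → x ≋ y
  ≋-reflexive {x} refl = ∣⇒≋ (divides (+ 0) (ℤP.+-inverseʳ x))

  ≋-refl : ∀ {x} → x ≋ x
  ≋-refl = ≋-reflexive refl

  ≋-sym : ∀ {x y} → x ≋ y → y ≋ x
  ≋-sym {x} {y} p = ≋-by (- + 1) (diff≋0 p) (solve (x ∷ y ∷ []))

  ≋-trans : ∀ {x y z} → x ≋ y → y ≋ z → x ≋ z
  ≋-trans {x} {y} {z} p q = combine (+ 1) (+ 1) (diff≋0 p) (diff≋0 q) (solve (x ∷ y ∷ z ∷ []))

  +-cong : ∀ {x x′ y y′} → x ≋ x′ → y ≋ y′ → x + y ≋ x′ + y′
  +-cong {x} {x′} {y} {y′} p q =
    combine (+ 1) (+ 1) (diff≋0 p) (diff≋0 q) (solve (x ∷ x′ ∷ y ∷ y′ ∷ []))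

  -‿cong : ∀ {x x′ y y′} → x ≋ x′ → y ≋ y′ → x - y ≋ x′ - y′
  -‿cong {x} {x′} {y} {y′} p q =
    combine (+ 1) (- + 1) (diff≋0 p) (diff≋0 q) (solve (x ∷ x′ ∷ y ∷ y′ ∷ []))

  *-cong : ∀ {x x′ y y′} → x ≋ x′ → y ≋ y′ → x * y ≋ x′ * y′
  *-cong {x} {x′} {y} {y′} p q =
    combine y x′ (diff≋0 p) (diff≋0 q) (solve (x ∷ x′ ∷ y ∷ y′ ∷ []))

  *-congˡ : ∀ x {y y′} → y ≋ y′ → x * y ≋ x * y′
  *-congˡ x = *-cong (≋-refl {x})

  *-congʳ : ∀ y {x x′} → x ≋ x′ → x * y ≋ x′ * y
  *-congʳ y p = *-cong p (≋-refl {y})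

  ^-cong : ∀ {x y} n → x ≋ y → x ℤ.^ n ≋ y ℤ.^ n
  ^-cong zero    p = ≋-refl
  ^-cong (suc n) p = *-cong p (^-cong n p)

  M≋0 : + M ≋ + 0
  M≋0 = ∣⇒≋ (subst (+ M ∣_) (sym (ℤP.+-identityʳ (+ M))) ∣-refl)

  ≋-isEquivalence : IsEquivalence _≋_
  ≋-isEquivalence = record { refl = ≋-refl ; sym = ≋-sym ; trans = ≋-trans }

  ≋-setoid : Setoid _ _
  ≋-setoid = record { isEquivalence = ≋-isEquivalence }

  module ≋-Reasoning = Relation.Binary.Reasoning.Setoid ≋-setoid

  Cancellable : ℤ → Set
  Cancellable z = ∀ {w} → z * w ≋ + 0 → w ≋ + 0

  record Unit (z : ℤ) : Set where
    constructor unit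
    field
      inverse     : ℤ
      inverse-law : z * inverse ≋ + 1

  cancellable-* : ∀ {x y} → Cancellable x → Cancellable y → Cancellable (x * y)
  cancellable-* {x} {y} cx cy {w} xyw≋0 =
    cy (cx (begin
      x * (y * w)  ≡⟨ solve (x ∷ y ∷ w ∷ []) ⟩
      (x * y) * w  ≈⟨ xyw≋0 ⟩
      + 0          ∎))
    where open ≋-Reasoning

  unit⇒cancellable : ∀ {z} → Unit z → Cancellable z
  unit⇒cancellable {z} (unit u zu≋1) {w} zw≋0 = begin
    w             ≡⟨ ℤP.*-identityˡ w ⟨
    + 1 * w       ≈⟨ *-congʳ w zu≋1 ⟨
    (z * u) * w   ≡⟨ solve (z ∷ u ∷ w ∷ []) ⟩
    u * (z * w)   ≈⟨ *-congˡ u zw≋0 ⟩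
    u * + 0       ≡⟨ ℤP.*-zeroʳ u ⟩
    + 0           ∎
    where open ≋-Reasoning

  unit-resp : ∀ {x y} → x ≋ y → Unit x → Unit y
  unit-resp x≋y (unit u xu≋1) = unit u (≋-trans (*-congʳ u (≋-sym x≋y)) xu≋1)

  unit-* : ∀ {x y} → Unit x → Unit y → Unit (x * y)
  unit-* {x} {y} (unit u xu≋1) (unit v yv≋1) = unit (u * v) (begin
    (x * y) * (u * v)  ≡⟨ solve (x ∷ y ∷ u ∷ v ∷ []) ⟩
    (x * u) * (y * v)  ≈⟨ *-cong xu≋1 yv≋1 ⟩
    + 1                ∎)
    where open ≋-Reasoning

  unit-factor : ∀ {x y} → Unit (x * y) → Unit x
  unit-factor {x} {y} (unit u xyu≋1) = unit (y * u) (begin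
    x * (y * u)  ≡⟨ solve (x ∷ y ∷ u ∷ []) ⟩
    (x * y) * u  ≈⟨ xyu≋1 ⟩
    + 1          ∎)
    where open ≋-Reasoning

  unit-neg : ∀ {x} → Unit x → Unit (- x)
  unit-neg {x} (unit u xu≋1) = unit (- u) (begin
    - x * - u  ≡⟨ solve (x ∷ u ∷ []) ⟩
    x * u      ≈⟨ xu≋1 ⟩
    + 1        ∎)
    where open ≋-Reasoning

  unit-1 : Unit (+ 1)
  unit-1 = unit (+ 1) ≋-refl

  6-unit⇒2-unit : Unit (+ 6) → Unit (+ 2)
  6-unit⇒2-unit = unit-factor {+ 2} {+ 3}

  6-unit⇒3-unit : Unit (+ 6) → Unit (+ 3)
  6-unit⇒3-unit = unit-factor {+ 3} {+ 2}

  6-unit⇒4-unit : Unit (+ 6) → Unit (+ 4)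
  6-unit⇒4-unit 6-unit = unit-* {+ 2} {+ 2} (6-unit⇒2-unit 6-unit) (6-unit⇒2-unit 6-unit)

  unit≉0 : ∀ {z} → ¬ (+ 1 ≋ + 0) → Unit z → ¬ (z ≋ + 0)
  unit≉0 {z} 1≉0 (unit u zu≋1) z≋0 = 1≉0 (begin
    + 1      ≈⟨ zu≋1 ⟨
    z * u    ≈⟨ *-congʳ u z≋0 ⟩
    + 0 * u  ≡⟨ ℤP.*-zeroˡ u ⟩
    + 0      ∎)
    where open ≋-Reasoning

-- the congruence of Congruence M, with the modulus displayed, for
-- statements involving several moduli
infix 4 _≈_⟨mod_⟩
_≈_⟨mod_⟩ : ℤ → ℤ → ℕ → Set
x ≈ y ⟨mod M ⟩ = Congruence._≋_ M x y

≋-divisor : ∀ {d M x y} → d ℕD.∣ M → x ≈ y ⟨mod M ⟩ → x ≈ y ⟨mod d ⟩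
≋-divisor d∣M (Congruence.mk≋ M∣x-y) = Congruence.mk≋ (ℕD.∣-trans d∣M M∣x-y)

unit-divisor : ∀ {d M z} → d ℕD.∣ M → Congruence.Unit M z → Congruence.Unit d z
unit-divisor d∣M (Congruence.unit u zu≋1) = Congruence.unit u (≋-divisor d∣M zu≋1)

-- Canonical representatives modulo M: they turn congruence into equality
-- of natural numbers, so that counting arguments about residues can be
-- carried out with propositional equality.
module Residues (M : ℕ) .{{_ : NonZero M}} where
  open Congruence M

  multiple<M⇒0 : ∀ {d} → d < M → ℕD._∣_ M d → d ≡ 0
  multiple<M⇒0 {zero}  _   _   = refl
  multiple<M⇒0 {suc d} d<M M∣d = contradiction (ℕD.∣⇒≤ M∣d) (ℕP.<⇒≱ d<M)

  ≤-≋⇒≡ : ∀ {m n} → m ≤ n → n < M → + m ≋ + n → m ≡ n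
  ≤-≋⇒≡ {m} {n} m≤n n<M (mk≋ M∣m-n) =
    ℕP.≤-antisym m≤n (ℕP.m∸n≡0⇒m≤n (multiple<M⇒0 (ℕP.≤-<-trans (ℕP.m∸n≤m n m) n<M) M∣n∸m))
    where
    M∣n∸m : ℕD._∣_ M (n ℕ.∸ m)
    M∣n∸m = subst (ℕD._∣_ M) (trans (cong ∣_∣ (ℤP.m-n≡m⊖n m n)) (ℤP.∣⊖∣-≤ m≤n)) M∣m-n

  small-≋⇒≡ : ∀ {m n} → m < M → n < M → + m ≋ + n → m ≡ n
  small-≋⇒≡ {m} {n} m<M n<M m≋n with ℕP.≤-total m n
  ... | inj₁ m≤n = ≤-≋⇒≡ m≤n n<M m≋n
  ... | inj₂ n≤m = sym (≤-≋⇒≡ n≤m m<M (≋-sym m≋n))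

  res : ℤ → ℕ
  res z = z %ℕ M

  res<M : ∀ z → res z < M
  res<M z = ℤDM.n%ℕd<d z M

  res≋ : ∀ z → + res z ≋ z
  res≋ z = ≋-by (- (z /ℕ M)) M≋0 (begin
    + res z - z                                    ≡⟨ cong (λ w → + res z - w) (ℤDM.a≡a%ℕn+[a/ℕn]*n z M) ⟩
    + res z - (+ res z + (z /ℕ M) * + M)           ≡⟨ cancel (+ res z) (z /ℕ M) (+ M) ⟩
    - (z /ℕ M) * + M                               ∎)
    where
    open ≡-Reasoning
    cancel : ∀ r q m → r - (r + q * m) ≡ - q * m
    cancel = solve-∀

  ≋⇒res≡ : ∀ {x y} → x ≋ y → res x ≡ res y
  ≋⇒res≡ {x} {y} x≋y =
    small-≋⇒≡ (res<M x) (res<M y) (≋-trans (res≋ x) (≋-trans x≋y (≋-sym (res≋ y))))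

  res≡⇒≋ : ∀ {x y} → res x ≡ res y → x ≋ y
  res≡⇒≋ {x} {y} eq = ≋-trans (≋-sym (res≋ x)) (≋-trans (≋-reflexive (cong +_ eq)) (res≋ y))

  vertex : ℤ → Fin M
  vertex z = fromℕ< (res<M z)

  ι-vertex : ∀ z → ι (vertex z) ≋ z
  ι-vertex z = subst (_≋ z) (cong +_ (sym (FinP.toℕ-fromℕ< (res<M z)))) (res≋ z)

  ι-injective : ∀ {x y : Fin M} → ι x ≋ ι y → x ≡ y
  ι-injective {x} {y} x≋y = FinP.toℕ-injective (small-≋⇒≡ (FinP.toℕ<n x) (FinP.toℕ<n y) x≋y)

  infix 4 _≋?_
  _≋?_ : ∀ x y → Dec (x ≋ y)
  x ≋? y = map′ res≡⇒≋ ≋⇒res≡ (res x ℕ.≟ res y)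

  interval : ℕ → ℕ → List ℤ
  interval c = applyUpTo (λ i → + (c ℕ.+ i))

  interval-distinct : ∀ c n → c ℕ.+ n ≤ M → DistinctMod M (interval c n)
  interval-distinct c n c+n≤M = AllPairs.applyUpTo⁺₁ _ n λ {i} {j} i<j j<n i≋j →
    ℕP.<-irrefl (ℕP.+-cancelˡ-≡ c i j (small-≋⇒≡ (below (ℕP.<-trans i<j j<n)) (below j<n) (mk≋ i≋j))) i<j
    where
    below : ∀ {i} → i < n → c ℕ.+ i < M
    below i<n = ℕP.<-≤-trans (ℕP.+-monoʳ-< c i<n) c+n≤M

  ∈-interval⁺ : ∀ {c n i} → i < n → + (c ℕ.+ i) ∈ interval c n
  ∈-interval⁺ {c} = ∈-applyUpTo⁺ (λ i → + (c ℕ.+ i))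

  ∈-interval⁻ : ∀ {c n x} → x ∈ interval c n → ∃[ i ] (i < n × x ≡ + (c ℕ.+ i))
  ∈-interval⁻ {c} x∈ with ∈-applyUpTo⁻ (λ i → + (c ℕ.+ i)) x∈
  ... | i , i<n , refl = i , i<n , refl

  length-interval : ∀ c n → length (interval c n) ≡ n
  length-interval c n = length-applyUpTo (λ i → + (c ℕ.+ i)) n

  infix 4 _⊆≋_
  _⊆≋_ : List ℤ → List ℤ → Set
  xs ⊆≋ ys = ∀ {x} → x ∈ xs → ∃[ y ] (y ∈ ys × x ≋ y)

  open Counting ℕP._≟_ using (unique-⊆-length≥⇒⊇)

  distinct⇒unique-res : ∀ {xs} → DistinctMod M xs → Unique (map res xs)
  distinct⇒unique-res distinct =
    AllPairs.map⁺ (AllPairs.map (λ {x} {y} x≉y eq → x≉y (unwrap (res≡⇒≋ {x} {y} eq))) distinct)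

  ⊆≋⇒⊆-res : ∀ {xs ys} → xs ⊆≋ ys → map res xs ⊆ map res ys
  ⊆≋⇒⊆-res {ys = ys} xs⊆≋ys r∈ with ∈-map⁻ res r∈
  ... | x , x∈xs , refl with xs⊆≋ys x∈xs
  ...   | y , y∈ys , x≋y = subst (_∈ map res ys) (sym (≋⇒res≡ x≋y)) (∈-map⁺ res y∈ys)

  ⊆-res⇒⊆≋ : ∀ {xs ys} → map res xs ⊆ map res ys → xs ⊆≋ ys
  ⊆-res⇒⊆≋ xs⊆ys x∈xs with ∈-map⁻ res (xs⊆ys (∈-map⁺ res x∈xs))
  ... | y , y∈ys , eq = y , y∈ys , res≡⇒≋ eq

  cover : ∀ {xs ys} → DistinctMod M xs → length ys ≤ length xs → xs ⊆≋ ys → ys ⊆≋ xs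
  cover {xs} {ys} distinct ys≤xs xs⊆≋ys = ⊆-res⇒⊆≋ (unique-⊆-length≥⇒⊇ (distinct⇒unique-res distinct)
    (subst₂ _≤_ (sym (length-map res ys)) (sym (length-map res xs)) ys≤xs) (⊆≋⇒⊆-res xs⊆≋ys))

  pointwise⇒⊆≋ : ∀ {xs ys} → Pointwise _≋_ xs ys → xs ⊆≋ ys
  pointwise⇒⊆≋ (x≋y Pointwise.∷ _)     (here refl) = _ , here refl , x≋y
  pointwise⇒⊆≋ (_   Pointwise.∷ xs≋ys) (there x∈)  =
    let (y , y∈ys , x≋y) = pointwise⇒⊆≋ xs≋ys x∈ in y , there y∈ys , x≋y

prod : List ℤ → ℤ
prod = foldr _*_ (+ 1)

module Lagrange (M : ℕ) .{{_ : NonZero M}} where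
  open Congruence M
  open Residues M
  open Counting ℕP._≟_ using (same-members⇒↭)

  prod-res : ∀ xs → + product (map res xs) ≋ prod xs
  prod-res []       = ≋-refl
  prod-res (x ∷ xs) = ≋-trans (≋-reflexive (ℤP.pos-* (res x) (product (map res xs))))
                              (*-cong (res≋ x) (prod-res xs))

  prod-scale : ∀ h xs → prod (map (h *_) xs) ≡ h ℤ.^ length xs * prod xs
  prod-scale h []       = sym (ℤP.*-identityˡ (+ 1))
  prod-scale h (x ∷ xs) = trans (cong (h * x *_) (prod-scale h xs)) (regroup h x (h ℤ.^ length xs) (prod xs))
    where
    regroup : ∀ h x hⁿ p → (h * x) * (hⁿ * p) ≡ (h * hⁿ) * (x * p)
    regroup = solve-∀

  prod-cancellable : ∀ {xs} → All Cancellable xs → Cancellable (prod xs)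
  prod-cancellable All.[]       {w} 1w≋0 = ≋-trans (≋-reflexive (sym (ℤP.*-identityˡ w))) 1w≋0
  prod-cancellable {x ∷ xs} (cx All.∷ cxs) = cancellable-* {x} {prod xs} cx (prod-cancellable cxs)

  -- Lagrange's argument: if multiplication by a cancellable h maps a list
  -- G of distinct cancellable residues into itself, it permutes G, and
  -- comparing the products of G and hG gives h^|G| ≡ 1.
  power-length≋1 : ∀ {G h} → DistinctMod M G → All Cancellable G → Cancellable h →
                   map (h *_) G ⊆≋ G → h ℤ.^ length G ≋ + 1
  power-length≋1 {G} {h} distinct cancellable cancel-h hG⊆≋G =
    diff≋0⁻¹ (prod-cancellable cancellable (≋-by (+ 1) (diff≋0 hⁿP≋P) (expand P hⁿ)))
    where
    hG : List ℤ
    hG = map (h *_) G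
    P hⁿ : ℤ
    P  = prod G
    hⁿ = h ℤ.^ length G

    expand : ∀ P hⁿ → P * (hⁿ - + 1) - + 0 ≡ + 1 * (hⁿ * P - P)
    expand = solve-∀

    distinct-hG : DistinctMod M hG
    distinct-hG = AllPairs.map⁺ (AllPairs.map (λ {g} {g′} g≉g′ hg≋hg′ →
      g≉g′ (unwrap (diff≋0⁻¹ {g} {g′} (cancel-h (≋-by (+ 1) (diff≋0 (mk≋ {h * g} {h * g′} hg≋hg′))
        (factor h g g′)))))) distinct)
      where
      factor : ∀ h g g′ → h * (g - g′) - + 0 ≡ + 1 * (h * g - h * g′)
      factor = solve-∀

    G⊆≋hG : G ⊆≋ hG
    G⊆≋hG = cover distinct-hG (ℕP.≤-reflexive (sym (length-map (h *_) G))) hG⊆≋G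

    same-product : product (map res hG) ≡ product (map res G)
    same-product = product-↭ (same-members⇒↭ (distinct⇒unique-res distinct-hG) (distinct⇒unique-res distinct)
                                             (⊆≋⇒⊆-res hG⊆≋G) (⊆≋⇒⊆-res G⊆≋hG))

    hⁿP≋P : hⁿ * P ≋ P
    hⁿP≋P = begin
      hⁿ * P                   ≡⟨ prod-scale h G ⟨
      prod hG                  ≈⟨ prod-res hG ⟨
      + product (map res hG)   ≡⟨ cong +_ same-product ⟩
      + product (map res G)    ≈⟨ prod-res G ⟩
      P                        ∎
      where open ≋-Reasoning

module Circulants (M : ℕ) .{{_ : NonZero M}} where
  open Congruence M
  open Residues M

  cay-valent : ∀ S → DistinctMod M S → Valent (length S) (Cay M S)
  cay-valent S distinct x = map neighbour S , length-map neighbour S , unique ,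
                            λ y → mk⇔ (adjacent⇒listed y) (listed⇒adjacent y)
    where
    neighbour : ℤ → Fin M
    neighbour s = vertex (ι x - s)

    minus-minus : ∀ a b → a - (a - b) ≡ b
    minus-minus = solve-∀

    neighbour≡⇒≋ : ∀ {s s′} → neighbour s ≡ neighbour s′ → s ≋ s′
    neighbour≡⇒≋ {s} {s′} eq = begin
      s                      ≡⟨ minus-minus (ι x) s ⟨
      ι x - (ι x - s)        ≈⟨ -‿cong (≋-refl {ι x}) (ι-vertex (ι x - s)) ⟨
      ι x - ι (neighbour s)  ≡⟨ cong (λ v → ι x - ι v) eq ⟩
      ι x - ι (neighbour s′) ≈⟨ -‿cong (≋-refl {ι x}) (ι-vertex (ι x - s′)) ⟩
      ι x - (ι x - s′)       ≡⟨ minus-minus (ι x) s′ ⟩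
      s′                     ∎
      where open ≋-Reasoning

    unique : Unique (map neighbour S)
    unique = AllPairs.map⁺ (AllPairs.map
      (λ {s} {s′} s≉s′ eq → s≉s′ (unwrap (neighbour≡⇒≋ {s} {s′} eq))) distinct)

    adjacent⇒listed : ∀ y → Cay M S x y → y ∈ map neighbour S
    adjacent⇒listed y (s , s∈S , x-y≡s) = subst (_∈ map neighbour S) (ι-injective {neighbour s} {y} (begin
      ι (neighbour s)  ≈⟨ ι-vertex (ι x - s) ⟩
      ι x - s          ≈⟨ -‿cong (≋-refl {ι x}) (mk≋ {ι x - ι y} {s} x-y≡s) ⟨
      ι x - (ι x - ι y) ≡⟨ minus-minus (ι x) (ι y) ⟩
      ι y              ∎)) (∈-map⁺ neighbour s∈S)
      where open ≋-Reasoning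

    listed⇒adjacent : ∀ y → y ∈ map neighbour S → Cay M S x y
    listed⇒adjacent y y∈ with ∈-map⁻ neighbour y∈
    ... | s , s∈S , refl = s , s∈S , unwrap (begin
      ι x - ι (neighbour s) ≈⟨ -‿cong (≋-refl {ι x}) (ι-vertex (ι x - s)) ⟩
      ι x - (ι x - s)       ≡⟨ minus-minus (ι x) s ⟩
      s                     ∎)
      where open ≋-Reasoning

  valency-unique : ∀ {Γ Δ : Graph M} {k n} (x : Fin M) → Valent k Γ → Valent n Δ →
                   (∀ y → Γ x y ⇔ Δ x y) → k ≡ n
  valency-unique {Γ} {Δ} x valent-Γ valent-Δ Γ⇔Δ = compare (valent-Γ x) (valent-Δ x)
    where
    open Counting FinP._≟_ using () renaming (same-members⇒length≡ to same-vertices⇒length≡)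
    compare : ∀ {k n} → ∃[ ys ] (length ys ≡ k × Unique ys × (∀ y → Γ x y ⇔ (y ∈ ys))) →
              ∃[ zs ] (length zs ≡ n × Unique zs × (∀ y → Δ x y ⇔ (y ∈ zs))) → k ≡ n
    compare (ys , refl , unique-ys , ys-lists) (zs , refl , unique-zs , zs-lists) =
      same-vertices⇒length≡ unique-ys unique-zs
        (λ {y} y∈ys → Equivalence.to (zs-lists y) (Equivalence.to (Γ⇔Δ y) (Equivalence.from (ys-lists y) y∈ys)))
        (λ {y} y∈zs → Equivalence.to (ys-lists y) (Equivalence.from (Γ⇔Δ y) (Equivalence.from (zs-lists y) y∈zs)))

  generated-by-1 : ∀ {S} → + 1 ∈ S → ∀ x → Gen M S x
  generated-by-1 {S} 1∈S = generate
    where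
    successor : ∀ n → + n - (+ 0 - + 1) ≡ + suc n
    successor n = trans (step (+ n)) (sym (ℤP.pos-+ 1 n))
      where
      step : ∀ x → x - (+ 0 - + 1) ≡ + 1 + x
      step = solve-∀

    generate-ℕ : ∀ n → Gen M S (+ n)
    generate-ℕ zero    = Gen.zero
    generate-ℕ (suc n) = mod (sub (generate-ℕ n) (sub Gen.zero (gen 1∈S))) (unwrap (≋-reflexive (successor n)))

    generate : ∀ x → Gen M S x
    generate (+ n)      = generate-ℕ n
    generate ℤ.-[1+ n ] = sub Gen.zero (generate-ℕ (suc n))

  generated-multiples : ∀ {a H x} → Gen M (map (λ h → h * a) H) x → ∃[ t ] (x ≋ a * t)
  generated-multiples {a} (gen s∈) = let (h , _ , s≡ha) = ∈-map⁻ (λ h → h * a) s∈ in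
                                     h , ≋-reflexive (trans s≡ha (ℤP.*-comm h a))
  generated-multiples {a} Gen.zero = + 0 , ≋-reflexive (sym (ℤP.*-zeroʳ a))
  generated-multiples {a} (sub gx gy) =
    let (s , x≋as) = generated-multiples gx ; (t , y≋at) = generated-multiples gy in
    s - t , ≋-trans (-‿cong x≋as y≋at) (≋-reflexive (distribute a s t))
    where
    distribute : ∀ a s t → a * s - a * t ≡ a * (s - t)
    distribute = solve-∀
  generated-multiples (mod {x} {y} gx x≡y) =
    let (s , x≋as) = generated-multiples gx in s , ≋-trans (≋-sym (mk≋ {x} {y} x≡y)) x≋as

-- f is a polynomial function of degree at most d: either constant, or of
-- the form x ↦ x · g(x) + a with g of degree at most d - 1.
data Degree≤ : ℕ → (ℤ → ℤ) → Set where
  const  : ∀ {d f} c → (∀ x → f x ≡ c) → Degree≤ d f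
  horner : ∀ {d f} g a → Degree≤ d g → (∀ x → f x ≡ x * g x + a) → Degree≤ (suc d) f

degree-suc : ∀ {d f} → Degree≤ d f → Degree≤ (suc d) f
degree-suc (const c f≡c)          = const c f≡c
degree-suc (horner g a deg-g f≡) = horner g a (degree-suc deg-g) f≡

degree-x* : ∀ {d f} → Degree≤ d f → Degree≤ (suc d) (λ x → x * f x)
degree-x* {f = f} deg-f = horner f (+ 0) deg-f (λ x → sym (ℤP.+-identityʳ (x * f x)))

degree-+ : ∀ {d f g} → Degree≤ d f → Degree≤ d g → Degree≤ d (λ x → f x + g x)
degree-+ (const c f≡) (const c′ g≡) = const (c + c′) (λ x → cong₂ _+_ (f≡ x) (g≡ x))
degree-+ (const c f≡) (horner g a deg-g g≡) = horner g (c + a) deg-g λ x →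
  trans (cong₂ _+_ (f≡ x) (g≡ x)) (shuffle x (g x) a c)
  where
  shuffle : ∀ x gx a c → c + (x * gx + a) ≡ x * gx + (c + a)
  shuffle = solve-∀
degree-+ (horner g a deg-g f≡) (const c g≡) = horner g (a + c) deg-g λ x →
  trans (cong₂ _+_ (f≡ x) (g≡ x)) (shuffle x (g x) a c)
  where
  shuffle : ∀ x gx a c → (x * gx + a) + c ≡ x * gx + (a + c)
  shuffle = solve-∀
degree-+ (horner g a deg-g f≡) (horner g′ a′ deg-g′ g≡) =
  horner (λ x → g x + g′ x) (a + a′) (degree-+ deg-g deg-g′) λ x →
    trans (cong₂ _+_ (f≡ x) (g≡ x)) (shuffle x (g x) a (g′ x) a′)
  where
  shuffle : ∀ x gx a g′x a′ → (x * gx + a) + (x * g′x + a′) ≡ x * (gx + g′x) + (a + a′)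
  shuffle = solve-∀

degree-scale : ∀ {d f} r → Degree≤ d f → Degree≤ d (λ x → r * f x)
degree-scale r (const c f≡) = const (r * c) (λ x → cong (r *_) (f≡ x))
degree-scale r (horner g a deg-g f≡) = horner (λ x → r * g x) (r * a) (degree-scale r deg-g) λ x →
  trans (cong (r *_) (f≡ x)) (shuffle x r (g x) a)
  where
  shuffle : ∀ x r gx a → r * (x * gx + a) ≡ x * (r * gx) + r * a
  shuffle = solve-∀

factor : ∀ {d f} → Degree≤ (suc d) f → ∀ r →
         ∃[ q ] (Degree≤ d q × (∀ x → f x - f r ≡ (x - r) * q x))
factor (const c f≡) r = (λ _ → + 0) , const (+ 0) (λ _ → refl) , λ x →
  trans (cong₂ _-_ (f≡ x) (f≡ r)) (vanish (x - r) c)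
  where
  vanish : ∀ y c → c - c ≡ y * + 0
  vanish = solve-∀
factor {zero} (horner g a (const c g≡) f≡) r = g , const c g≡ , λ x →
  trans (cong₂ _-_ (f≡ x) (f≡ r))
        (trans (cong₂ (λ u v → (x * u + a) - (r * v + a)) (g≡ x) (g≡ r))
               (trans (linear x r c a) (cong ((x - r) *_) (sym (g≡ x)))))
  where
  linear : ∀ x r c a → (x * c + a) - (r * c + a) ≡ (x - r) * c
  linear = solve-∀
factor {suc d} (horner g a deg-g f≡) r with factor deg-g r
... | q , deg-q , g-split = (λ x → g x + r * q x) , degree-+ deg-g (degree-suc (degree-scale r deg-q)) , λ x →
  trans (cong₂ _-_ (f≡ x) (f≡ r)) (combine x r (g x) (g r) a (q x) (g-split x))
  where
  combine : ∀ x r gx gr a qx → gx - gr ≡ (x - r) * qx →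
            (x * gx + a) - (r * gr + a) ≡ (x - r) * (gx + r * qx)
  combine x r gx gr a qx eq = begin
    (x * gx + a) - (r * gr + a)   ≡⟨ expand x r gx gr a ⟩
    (x - r) * gx + r * (gx - gr)  ≡⟨ cong (λ w → (x - r) * gx + r * w) eq ⟩
    (x - r) * gx + r * ((x - r) * qx) ≡⟨ collect x r gx qx ⟩
    (x - r) * (gx + r * qx)       ∎
    where
    open ≡-Reasoning
    expand : ∀ x r gx gr a → (x * gx + a) - (r * gr + a) ≡ (x - r) * gx + r * (gx - gr)
    expand = solve-∀
    collect : ∀ x r gx qx → (x - r) * gx + r * ((x - r) * qx) ≡ (x - r) * (gx + r * qx)
    collect = solve-∀

suc<⇒<pred : ∀ {i n} → suc i < n → i < n ℕ.∸ 1
suc<⇒<pred {n = suc n} (s≤s i<n) = i<n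

<pred⇒suc< : ∀ {i n} → i < n ℕ.∸ 1 → suc i < n
<pred⇒suc< {n = suc n} i<n = s≤s i<n

module ModPrime (p : ℕ) (p-prime : Prime p) where
  instance
    p≢0 : NonZero p
    p≢0 = prime⇒nonZero p-prime

  open Congruence p
  open Residues p
  open Lagrange p

  1<p : 1 < p
  1<p = ℕ.nonTrivial⇒n>1 p {{prime⇒nonTrivial p-prime}}

  small≉0 : ∀ {n} → 0 < n → n < p → ¬ (+ n ≋ + 0)
  small≉0 {suc n} _ n<p n≋0 with small-≋⇒≡ n<p (ℕP.<-trans (s≤s z≤n) 1<p) n≋0
  ... | ()

  euclid : ∀ {x y} → x * y ≋ + 0 → x ≋ + 0 ⊎ y ≋ + 0
  euclid {x} {y} xy≋0
    with euclidsLemma ∣ x ∣ ∣ y ∣ p-prime (subst (p ℕD.∣_) (ℤP.abs-* x y) (≋0⇒∣∣ xy≋0))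
  ... | inj₁ p∣x = inj₁ (∣∣⇒≋0 p∣x)
  ... | inj₂ p∣y = inj₂ (∣∣⇒≋0 p∣y)

  nonzero⇒cancellable : ∀ {z} → ¬ (z ≋ + 0) → Cancellable z
  nonzero⇒cancellable z≉0 zw≋0 with euclid zw≋0
  ... | inj₁ z≋0 = contradiction z≋0 z≉0
  ... | inj₂ w≋0 = w≋0

  root-bound : ∀ {d f} → Degree≤ d f → (rs : List ℤ) → length rs ≡ suc d →
               DistinctMod p rs → All (λ r → f r ≋ + 0) rs → ∀ x → f x ≋ + 0
  root-bound {zero} (const c f≡) (r ∷ []) _ _ (fr≋0 All.∷ All.[]) x =
    ≋-trans (≋-reflexive (trans (f≡ x) (sym (f≡ r)))) fr≋0
  root-bound {suc d} {f} deg-f (r ∷ rs) len (r≉rs AllPairs.∷ distinct) (fr≋0 All.∷ frs≋0) x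
    with factor deg-f r
  ... | q , deg-q , split = begin
      f x                    ≡⟨ solve-at (f x) (f r) ⟩
      f r + (f x - f r)      ≡⟨ cong (λ w → f r + w) (split x) ⟩
      f r + (x - r) * q x    ≈⟨ +-cong fr≋0 (*-congˡ (x - r) (q≋0 x)) ⟩
      + 0 + (x - r) * + 0    ≡⟨ ℤP.+-identityˡ ((x - r) * + 0) ⟩
      (x - r) * + 0          ≡⟨ ℤP.*-zeroʳ (x - r) ⟩
      + 0                    ∎
    where
    open ≋-Reasoning
    solve-at : ∀ a b → a ≡ b + (a - b)
    solve-at = solve-∀
    -- the other roots of f are roots of q, since r′ - r does not vanish
    q-roots : All (λ r′ → q r′ ≋ + 0) rs
    q-roots = All.zipWith (λ { {r′} (r≉r′ , fr′≋0) →
      nonzero⇒cancellable {r′ - r} (λ r′-r≋0 → r≉r′ (unwrap (≋-sym (diff≋0⁻¹ {r′} {r} r′-r≋0))))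
        (≋-trans (≋-reflexive (sym (split r′))) (diff≋0 {f r′} {f r} (≋-trans fr′≋0 (≋-sym fr≋0)))) })
      (r≉rs , frs≋0)
    q≋0 : ∀ y → q y ≋ + 0
    q≋0 = root-bound deg-q rs (ℕP.suc-injective len) distinct q-roots

  -- Fermat's little theorem: multiplication by y ≢ 0 maps the nonzero
  -- residues 1, …, p-1 into themselves, so Lagrange's argument applies
  fermat : ∀ {y} → ¬ (y ≋ + 0) → y ℤ.^ (p ℕ.∸ 1) ≋ + 1
  fermat {y} y≉0 = subst (λ n → y ℤ.^ n ≋ + 1) (length-interval 1 (p ℕ.∸ 1))
    (power-length≋1 (interval-distinct 1 (p ℕ.∸ 1) (ℕP.≤-reflexive (ℕP.m+[n∸m]≡n (ℕP.<⇒≤ 1<p))))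
                    (All.tabulate (nonzero⇒cancellable ∘ nonzero)) (nonzero⇒cancellable y≉0) closed)
    where
    G : List ℤ
    G = interval 1 (p ℕ.∸ 1)

    nonzero : ∀ {g} → g ∈ G → ¬ (g ≋ + 0)
    nonzero g∈G with ∈-interval⁻ g∈G
    ... | i , i<p-1 , refl = small≉0 (s≤s z≤n) (<pred⇒suc< i<p-1)

    closed : map (y *_) G ⊆≋ G
    closed yg∈ with ∈-map⁻ (y *_) yg∈
    ... | g , g∈G , refl with res (y * g) in res≡ | res<M (y * g)
    ...   | zero  | _ = contradiction (≋-trans (≋-sym (res≋ (y * g))) (≋-reflexive (cong +_ res≡)))
                          (λ yg≋0 → [ y≉0 , nonzero g∈G ]′ (euclid yg≋0))
    ...   | suc j | j<p = + suc j , ∈-interval⁺ (suc<⇒<pred j<p) ,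
                        ≋-trans (≋-sym (res≋ (y * g))) (≋-reflexive (cong +_ res≡))

  nonzero⇒unit : ∀ {y} → ¬ (y ≋ + 0) → Unit y
  nonzero⇒unit {y} y≉0 = unit (y ℤ.^ (p ℕ.∸ 2)) (subst (λ n → y ℤ.^ n ≋ + 1) p-1≡1+[p-2] (fermat y≉0))
    where
    p-1≡1+[p-2] : p ℕ.∸ 1 ≡ suc (p ℕ.∸ 2)
    p-1≡1+[p-2] = ℕP.+-∸-assoc 1 1<p

cubeSum : ℕ → ℤ → ℤ
cubeSum zero    y = + 0
cubeSum (suc j) y = + 1 + y ℤ.^ 3 * cubeSum j y

cubeSum-degree : ∀ j → Degree≤ (3 ℕ.* j) (cubeSum (suc j))
cubeSum-degree zero    = const (+ 1) one
  where
  one : ∀ y → + 1 + y * (y * (y * + 1)) * + 0 ≡ + 1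
  one = solve-∀
cubeSum-degree (suc j) = subst (λ d → Degree≤ d (cubeSum (suc (suc j)))) (sym (ℕP.*-suc 3 j))
  (horner (λ y → y * (y * cubeSum (suc j) y)) (+ 1) (degree-x* (degree-x* (cubeSum-degree j)))
          (λ y → horner-form y (cubeSum (suc j) y)))
  where
  horner-form : ∀ y Q → + 1 + y * (y * (y * + 1)) * Q ≡ y * (y * (y * Q)) + + 1
  horner-form = solve-∀

cubeSum-geometric : ∀ j y → (y ℤ.^ 3 - + 1) * cubeSum j y ≡ y ℤ.^ (3 ℕ.* j) - + 1
cubeSum-geometric zero    y = ℤP.*-zeroʳ (y ℤ.^ 3 - + 1)
cubeSum-geometric (suc j) y = begin
  (y³ - + 1) * (+ 1 + y³ * cubeSum j y)          ≡⟨ expand y³ (cubeSum j y) ⟩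
  (y³ - + 1) + y³ * ((y³ - + 1) * cubeSum j y)   ≡⟨ cong (λ w → (y³ - + 1) + y³ * w) (cubeSum-geometric j y) ⟩
  (y³ - + 1) + y³ * (y ℤ.^ (3 ℕ.* j) - + 1)      ≡⟨ collect y³ (y ℤ.^ (3 ℕ.* j)) ⟩
  y³ * y ℤ.^ (3 ℕ.* j) - + 1                     ≡⟨ cong (_- + 1) (ℤP.^-distribˡ-+-* y 3 (3 ℕ.* j)) ⟨
  y ℤ.^ (3 ℕ.+ 3 ℕ.* j) - + 1                    ≡⟨ cong (λ n → y ℤ.^ n - + 1) (ℕP.*-suc 3 j) ⟨
  y ℤ.^ (3 ℕ.* suc j) - + 1                      ∎
  where
  open ≡-Reasoning
  y³ : ℤ
  y³ = y ℤ.^ 3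
  expand : ∀ c Q → (c - + 1) * (+ 1 + c * Q) ≡ (c - + 1) + c * ((c - + 1) * Q)
  expand = solve-∀
  collect : ∀ c d → (c - + 1) + c * (d - + 1) ≡ c * d - + 1
  collect = solve-∀

-- A prime p = 3(j+1) + 1 has a primitive cube root of unity.  Otherwise
-- y² + y + 1 ≢ 0 for all y, so by Fermat every y = 2, …, p-1 is a root
-- of cubeSum (j+1) = (y^(p-1) - 1)/(y³ - 1); these are more roots than
-- its degree 3j allows, so it would vanish at 0, where it equals 1.
module CubeRoot (p : ℕ) (p-prime : Prime p) (j : ℕ) (p≡ : p ≡ suc (3 ℕ.* suc j)) where
  open ModPrime p p-prime
  open Congruence p
  open Residues p

  private
    roots≤p : 2 ℕ.+ suc (3 ℕ.* j) ≤ p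
    roots≤p = ℕP.≤-trans (ℕP.≤-reflexive (sym (ℕP.*-suc 3 j)))
                         (ℕP.≤-trans (ℕP.n≤1+n _) (ℕP.≤-reflexive (sym p≡)))

  cubeSum-root : ∀ {y} → ¬ (y ≋ + 0) → ¬ (y - + 1 ≋ + 0) → ¬ (y * y + y + + 1 ≋ + 0) →
                 cubeSum (suc j) y ≋ + 0
  cubeSum-root {y} y≉0 y-1≉0 Φ≉0 = nonzero⇒cancellable {y ℤ.^ 3 - + 1} y³-1≉0 {cubeSum (suc j) y} (begin
      (y ℤ.^ 3 - + 1) * cubeSum (suc j) y   ≡⟨ cubeSum-geometric (suc j) y ⟩
      y ℤ.^ (3 ℕ.* suc j) - + 1             ≈⟨ -‿cong y^[p-1]≋1 (≋-refl {+ 1}) ⟩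
      + 1 - + 1                             ≡⟨⟩
      + 0                                   ∎)
    where
    open ≋-Reasoning
    p-1≡3[1+j] : p ℕ.∸ 1 ≡ 3 ℕ.* suc j
    p-1≡3[1+j] = cong (ℕ._∸ 1) p≡
    y^[p-1]≋1 : y ℤ.^ (3 ℕ.* suc j) ≋ + 1
    y^[p-1]≋1 = subst (λ n → y ℤ.^ n ≋ + 1) p-1≡3[1+j] (fermat y≉0)
    -- y³ - 1 = (y - 1)(y² + y + 1), with y³ unfolded for the ring solver
    factorise : ∀ y → y * (y * (y * + 1)) - + 1 ≡ (y - + 1) * (y * y + y + + 1)
    factorise = solve-∀
    y³-1≉0 : ¬ (y ℤ.^ 3 - + 1 ≋ + 0)
    y³-1≉0 y³-1≋0 = [ y-1≉0 , Φ≉0 ]′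
      (euclid {y - + 1} {y * y + y + + 1} (≋-trans (≋-reflexive (sym (factorise y))) y³-1≋0))

  cube-root-of-unity : ∃[ x ] (x * x + x + + 1 ≋ + 0)
  cube-root-of-unity = from-search (FinP.any? (λ i → (ι i * ι i + ι i + + 1) ≋? + 0))
    where
    from-search : Dec (∃[ i ] (ι {p} i * ι i + ι i + + 1 ≋ + 0)) → ∃[ x ] (x * x + x + + 1 ≋ + 0)
    from-search (yes (i , root)) = ι i , root
    from-search (no no-root)     =
      contradiction (root-bound (cubeSum-degree j) (interval 2 (suc (3 ℕ.* j))) (length-interval 2 _)
                                (interval-distinct 2 _ roots≤p) (All.tabulate Q-root) (+ 0))
                    (small≉0 (s≤s z≤n) 1<p)
      where
      nonroot : ∀ {y} → y < p → ¬ (+ y * + y + + y + + 1 ≋ + 0)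
      nonroot {y} y<p root = no-root (fromℕ< y<p , subst (λ z → z * z + z + + 1 ≋ + 0)
                                                          (cong +_ (sym (FinP.toℕ-fromℕ< y<p))) root)

      Q-root-at : ∀ {y} → ∃[ i ] (i < suc (3 ℕ.* j) × y ≡ + (2 ℕ.+ i)) → cubeSum (suc j) y ≋ + 0
      Q-root-at (i , i<3j+1 , refl) =
        cubeSum-root (small≉0 (s≤s z≤n) y<p) (small≉0 (s≤s z≤n) (ℕP.<-trans (ℕP.n<1+n _) y<p)) (nonroot y<p)
        where
        y<p : 2 ℕ.+ i < p
        y<p = ℕP.<-≤-trans (ℕP.+-monoʳ-< 2 i<3j+1) roots≤p

      Q-root : ∀ {y} → y ∈ interval 2 (suc (3 ℕ.* j)) → cubeSum (suc j) y ≋ + 0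
      Q-root y∈ = Q-root-at (∈-interval⁻ y∈)

hensel-identity : ∀ v c t w u P A → v * v - c ≡ t * (P * A) → + 2 * v * w - + 1 ≡ u * P →
  (v - t * w * (P * A)) * (v - t * w * (P * A)) - c ≡ (- (t * u) + t * t * w * w * A) * (P * (P * A))
hensel-identity v c t w u P A e₁ e₂ = begin
  (v - t * w * (P * A)) * (v - t * w * (P * A)) - c
    ≡⟨ expand v c t w P A ⟩
  (v * v - c) - t * (P * A) * (+ 2 * v * w - + 1) - t * (P * A) + t * t * w * w * (P * A) * (P * A)
    ≡⟨ cong₂ (λ a b → a - t * (P * A) * b - t * (P * A) + t * t * w * w * (P * A) * (P * A)) e₁ e₂ ⟩
  t * (P * A) - t * (P * A) * (u * P) - t * (P * A) + t * t * w * w * (P * A) * (P * A)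
    ≡⟨ collect t w u P A ⟩
  (- (t * u) + t * t * w * w * A) * (P * (P * A))
    ∎
  where
  open ≡-Reasoning
  expand : ∀ v c t w P A → (v - t * w * (P * A)) * (v - t * w * (P * A)) - c ≡
    (v * v - c) - t * (P * A) * (+ 2 * v * w - + 1) - t * (P * A) + t * t * w * w * (P * A) * (P * A)
  expand = solve-∀
  collect : ∀ t w u P A → t * (P * A) - t * (P * A) * (u * P) - t * (P * A) + t * t * w * w * (P * A) * (P * A)
    ≡ (- (t * u) + t * t * w * w * A) * (P * (P * A))
  collect = solve-∀

module Hensel (p : ℕ) (p-prime : Prime p) {c : ℤ} where
  open ModPrime p p-prime
  open Congruence p renaming (_≋_ to _≋ₚ_)

  hensel-step : ¬ (+ 2 ≋ₚ + 0) → ¬ (c ≋ₚ + 0) → ∀ n →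
    ∃[ v ] (v * v ≈ c ⟨mod p ^ suc n ⟩) → ∃[ v ] (v * v ≈ c ⟨mod p ^ suc (suc n) ⟩)
  hensel-step 2≉0 c≉0 n (v , v²≋c) = v′ , ≋ₙ₊₂.∣⇒≋ (divides K v′²-c≡K·pⁿ⁺²)
    where
    module ≋ₙ₊₁ = Congruence (p ^ suc n)
    module ≋ₙ₊₂ = Congruence (p ^ suc (suc n))

    2v≉0 : ¬ (+ 2 * v ≋ₚ + 0)
    2v≉0 2v≋0 = [ 2≉0 , v≉0 ]′ (euclid {+ 2} {v} 2v≋0)
      where
      v≉0 : ¬ (v ≋ₚ + 0)
      v≉0 v≋0 = c≉0 (≋-trans (≋-divisor (ℕD.m∣m*n (p ^ n)) (≋ₙ₊₁.≋-sym v²≋c))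
                             (*-cong v≋0 v≋0))

    t : ℤ
    t = quotient (≋ₙ₊₁.≋⇒∣ v²≋c)
    e₁ : v * v - c ≡ t * + (p ^ suc n)
    e₁ = _∣_.equality (≋ₙ₊₁.≋⇒∣ v²≋c)
    w : ℤ
    w = Unit.inverse (nonzero⇒unit 2v≉0)
    u : ℤ
    u = quotient (≋⇒∣ (Unit.inverse-law (nonzero⇒unit 2v≉0)))
    e₂ : + 2 * v * w - + 1 ≡ u * + p
    e₂ = _∣_.equality (≋⇒∣ (Unit.inverse-law (nonzero⇒unit 2v≉0)))

    P A : ℤ
    P = + p
    A = + (p ^ n)
    v′ K : ℤ
    v′ = v - t * w * (P * A)
    K = - (t * u) + t * t * w * w * A
    pⁿ⁺¹≡ : + (p ^ suc n) ≡ P * A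
    pⁿ⁺¹≡ = ℤP.pos-* p (p ^ n)
    pⁿ⁺²≡ : + (p ^ suc (suc n)) ≡ P * (P * A)
    pⁿ⁺²≡ = trans (ℤP.pos-* p (p ^ suc n)) (cong (P *_) pⁿ⁺¹≡)
    v′²-c≡K·pⁿ⁺² : v′ * v′ - c ≡ K * + (p ^ suc (suc n))
    v′²-c≡K·pⁿ⁺² = trans (hensel-identity v c t w u P A (trans e₁ (cong (t *_) pⁿ⁺¹≡)) e₂)
                         (cong (K *_) (sym pⁿ⁺²≡))

  sqrt-lift : ¬ (+ 2 ≋ₚ + 0) → ¬ (c ≋ₚ + 0) → ∃[ v ] (v * v ≋ₚ c) →
              ∀ n → ∃[ v ] (v * v ≈ c ⟨mod p ^ suc n ⟩)
  sqrt-lift 2≉0 c≉0 (v , v²≋c) zero    = v , ≋-divisor (ℕD.∣-reflexive (ℕP.*-identityʳ p)) v²≋c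
  sqrt-lift 2≉0 c≉0 root       (suc n) = hensel-step 2≉0 c≉0 n (sqrt-lift 2≉0 c≉0 root n)

-- -3 is a square modulo every power of a prime p ≡ 1 (mod 6): if x is a
-- primitive cube root of unity modulo p then (2x + 1)² ≡ -3, and Hensel
-- lifting applies since p ∤ 6
sqrt-minus-3 : ∀ p → Prime p → ∀ k → p ≡ suc (6 ℕ.* suc k) →
               ∀ n → ∃[ v ] (v * v ≈ - + 3 ⟨mod p ^ suc n ⟩)
sqrt-minus-3 p p-prime k p≡ = Hensel.sqrt-lift p p-prime (small≉0 (s≤s z≤n) 2<p) -3≉0 sqrt-mod-p
  where
  open ModPrime p p-prime
  open Congruence p

  7≤p : 7 ≤ p
  7≤p = ℕP.≤-trans (s≤s (ℕP.*-monoʳ-≤ 6 (s≤s (z≤n {k})))) (ℕP.≤-reflexive (sym p≡))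

  2<p : 2 < p
  2<p = ℕP.<-≤-trans (ℕP.+-monoʳ-< 2 (s≤s (z≤n {4}))) 7≤p

  -3≉0 : ¬ (- + 3 ≋ + 0)
  -3≉0 -3≋0 = small≉0 (s≤s z≤n) (ℕP.<-≤-trans (ℕP.+-monoʳ-< 3 (s≤s (z≤n {3}))) 7≤p)
                      (≋-by (- + 1) -3≋0 refl)

  p≡1+3[1+j] : p ≡ suc (3 ℕ.* suc (suc (2 ℕ.* k)))
  p≡1+3[1+j] = trans p≡ (cong suc (six k))
    where
    six : ∀ k → 6 ℕ.* suc k ≡ 3 ℕ.* suc (suc (2 ℕ.* k))
    six = ℕ-solve-∀

  sqrt-mod-p : ∃[ v ] (v * v ≋ - + 3)
  sqrt-mod-p = square-root (CubeRoot.cube-root-of-unity p p-prime (suc (2 ℕ.* k)) p≡1+3[1+j])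
    where
    square : ∀ x → (+ 2 * x + + 1) * (+ 2 * x + + 1) - - + 3 ≡ + 4 * (x * x + x + + 1)
    square = solve-∀
    square-root : ∃[ x ] (x * x + x + + 1 ≋ + 0) → ∃[ v ] (v * v ≋ - + 3)
    square-root (x , x²+x+1≋0) = + 2 * x + + 1 , ≋-by (+ 4) x²+x+1≋0 (square x)

-- The sixth roots of unity attached to a root A of x² - x + 1 modulo M,
-- where 6 is invertible modulo M and M ≠ 1: A is a primitive sixth root
-- of unity, and its powers 1, A, …, A⁵ are the residues
-- ±1, ±A, ±(A - 1), any two of which differ by a unit.
module SixthRoots (M : ℕ) .{{_ : NonZero M}} (A : ℤ)
                  (Φ : A * A - A + + 1 ≈ + 0 ⟨mod M ⟩)
                  (6-unit : Congruence.Unit M (+ 6))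
                  (1≉0 : ¬ (+ 1 ≈ + 0 ⟨mod M ⟩)) where
  open Congruence M
  open Residues M
  open Circulants M

  record Apart (u v : ℤ) : Set where
    constructor apart
    field difference-unit : Unit (u - v)

  apart⇒≉ : ∀ {u v} → Apart u v → ¬ (u ≋ v)
  apart⇒≉ (apart d) u≋v = unit≉0 1≉0 d (diff≋0 u≋v)

  apart-sym : ∀ {u v} → Apart u v → Apart v u
  apart-sym {u} {v} (apart d) = apart (unit-resp (≋-reflexive (negate u v)) (unit-neg d))
    where
    negate : ∀ u v → - (u - v) ≡ v - u
    negate = solve-∀

  apart-resp : Apart Respects₂ _≋_
  apart-resp = (λ {u} v≋v′ (apart d) → apart (unit-resp (-‿cong (≋-refl {u}) v≋v′) d))
             , (λ {v} u≋u′ (apart d) → apart (unit-resp (-‿cong u≋u′ (≋-refl {v})) d))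

  -- α A + β is a unit when its norm α² + αβ + β² is: its inverse is
  -- (α (1 - A) + β) / (α² + αβ + β²)
  norm-unit : ∀ α β → Unit (α * α + α * β + β * β) → Unit (α * A + β)
  norm-unit α β (unit u nu≋1) = unit ((α * (+ 1 - A) + β) * u)
    (combine (+ 1) (- (α * α * u)) (diff≋0 nu≋1) Φ (solve (α ∷ β ∷ A ∷ u ∷ [])))

  unit-3 : Unit (+ 3)
  unit-3 = 6-unit⇒3-unit 6-unit

  unit-4 : Unit (+ 4)
  unit-4 = 6-unit⇒4-unit 6-unit

  -- the powers of A, reduced with A² = A - 1 (the ring solver sees the
  -- unfolded products A * (A * …) rather than A ℤ.^ k)
  A¹≋A : A ℤ.^ 1 ≋ A
  A¹≋A = ≋-reflexive (ℤP.*-identityʳ A)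

  A²≋A-1 : A ℤ.^ 2 ≋ A - + 1
  A²≋A-1 = ≋-by (+ 1) Φ reduce
    where
    reduce : A * (A * + 1) - (A - + 1) ≡ + 1 * (A * A - A + + 1)
    reduce = solve (A ∷ [])

  A³≋-1 : A ℤ.^ 3 ≋ - + 1
  A³≋-1 = ≋-by (A + + 1) Φ reduce
    where
    reduce : A * (A * (A * + 1)) - - + 1 ≡ (A + + 1) * (A * A - A + + 1)
    reduce = solve (A ∷ [])

  A⁴≋-A : A ℤ.^ 4 ≋ - A
  A⁴≋-A = ≋-by (A * A + A) Φ reduce
    where
    reduce : A * (A * (A * (A * + 1))) - - A ≡ (A * A + A) * (A * A - A + + 1)
    reduce = solve (A ∷ [])

  A⁵≋-[A-1] : A ℤ.^ 5 ≋ - (A - + 1)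
  A⁵≋-[A-1] = ≋-by (A * A * A + A * A - + 1) Φ reduce
    where
    reduce : A * (A * (A * (A * (A * + 1)))) - - (A - + 1) ≡ (A * A * A + A * A - + 1) * (A * A - A + + 1)
    reduce = solve (A ∷ [])

  A⁶≋1 : A ℤ.^ 6 ≋ + 1
  A⁶≋1 = ≋-by ((A * A * A - + 1) * (A + + 1)) Φ reduce
    where
    reduce : A * (A * (A * (A * (A * (A * + 1))))) - + 1 ≡ ((A * A * A - + 1) * (A + + 1)) * (A * A - A + + 1)
    reduce = solve (A ∷ [])

  A^n≋A^[n%6] : ∀ n → A ℤ.^ n ≋ A ℤ.^ (n ℕ.% 6)
  A^n≋A^[n%6] n = begin
    A ℤ.^ n                             ≡⟨ cong (A ℤ.^_) (ℕDM.m≡m%n+[m/n]*n n 6) ⟩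
    A ℤ.^ (r ℕ.+ q ℕ.* 6)               ≡⟨ ℤP.^-distribˡ-+-* A r (q ℕ.* 6) ⟩
    A ℤ.^ r * A ℤ.^ (q ℕ.* 6)             ≡⟨ cong (λ m → A ℤ.^ r * A ℤ.^ m) (ℕP.*-comm q 6) ⟩
    A ℤ.^ r * A ℤ.^ (6 ℕ.* q)             ≡⟨ cong (A ℤ.^ r *_) (ℤP.^-*-assoc A 6 q) ⟨
    A ℤ.^ r * (A ℤ.^ 6) ℤ.^ q               ≈⟨ *-congˡ (A ℤ.^ r) (^-cong q A⁶≋1) ⟩
    A ℤ.^ r * (+ 1) ℤ.^ q                 ≡⟨ cong (A ℤ.^ r *_) (ℤP.^-zeroˡ q) ⟩
    A ℤ.^ r * + 1                       ≡⟨ ℤP.*-identityʳ (A ℤ.^ r) ⟩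
    A ℤ.^ r                             ∎
    where
    open ≋-Reasoning
    r q : ℕ
    r = n ℕ.% 6
    q = n ℕ./ 6

  A^-unit : ∀ n → Unit (A ℤ.^ n)
  A^-unit zero    = unit-1
  A^-unit (suc n) = unit-* {A} {A ℤ.^ n} (unit (A ℤ.^ 5) A⁶≋1) (A^-unit n)

  reduced-unit : ∀ d {r} α β → A ℤ.^ d ≋ r → α * A + β ≡ r - + 1 →
                 Unit (α * α + α * β + β * β) → Unit (A ℤ.^ d - + 1)
  reduced-unit d {r} α β A^d≋r eq norm =
    unit-resp (≋-trans (≋-reflexive eq) (-‿cong (≋-sym A^d≋r) (≋-refl {+ 1}))) (norm-unit α β norm)

  -- A, …, A⁵ differ from 1 by units: each A^d - 1 is some α A + β of norm
  -- 1, 3 or 4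
  A^d-1-unit : ∀ {d} → 0 < d → d < 6 → Unit (A ℤ.^ d - + 1)
  A^d-1-unit {1} _ _ = reduced-unit 1 (+ 1) (- + 1) A¹≋A (solve (A ∷ [])) unit-1
  A^d-1-unit {2} _ _ = reduced-unit 2 (+ 1) (- + 2) A²≋A-1 (solve (A ∷ [])) unit-3
  A^d-1-unit {3} _ _ = reduced-unit 3 (+ 0) (- + 2) A³≋-1 (solve (A ∷ [])) unit-4
  A^d-1-unit {4} _ _ = reduced-unit 4 (- + 1) (- + 1) A⁴≋-A (solve (A ∷ [])) unit-3
  A^d-1-unit {5} _ _ = reduced-unit 5 (- + 1) (+ 0) A⁵≋-[A-1] (solve (A ∷ [])) unit-1
  A^d-1-unit {suc (suc (suc (suc (suc (suc _)))))} _ (s≤s (s≤s (s≤s (s≤s (s≤s (s≤s ())))))) 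

  -- distinct powers A^m, A^n with m < n < 6 differ by the unit A^m (A^(n-m) - 1)
  powers-apart< : ∀ {m n} → m < n → n < 6 → Apart (A ℤ.^ n) (A ℤ.^ m)
  powers-apart< {m} {n} m<n n<6 = apart (unit-resp (≋-reflexive split-off)
    (unit-* {A ℤ.^ m} {A ℤ.^ (n ℕ.∸ m) - + 1} (A^-unit m)
      (A^d-1-unit (ℕP.m<n⇒0<n∸m m<n) (ℕP.≤-<-trans (ℕP.m∸n≤m n m) n<6))))
    where
    open ≡-Reasoning
    distribute : ∀ a b → a * (b - + 1) ≡ a * b - a
    distribute = solve-∀
    split-off : A ℤ.^ m * (A ℤ.^ (n ℕ.∸ m) - + 1) ≡ A ℤ.^ n - A ℤ.^ m
    split-off = begin
      A ℤ.^ m * (A ℤ.^ (n ℕ.∸ m) - + 1)      ≡⟨ distribute (A ℤ.^ m) (A ℤ.^ (n ℕ.∸ m)) ⟩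
      A ℤ.^ m * A ℤ.^ (n ℕ.∸ m) - A ℤ.^ m    ≡⟨ cong (_- A ℤ.^ m) (ℤP.^-distribˡ-+-* A m (n ℕ.∸ m)) ⟨
      A ℤ.^ (m ℕ.+ (n ℕ.∸ m)) - A ℤ.^ m      ≡⟨ cong (λ k → A ℤ.^ k - A ℤ.^ m) (ℕP.m+[n∸m]≡n (ℕP.<⇒≤ m<n)) ⟩
      A ℤ.^ n - A ℤ.^ m                      ∎

  powers-apart : ∀ {m n} → m < 6 → n < 6 → m ≢ n → Apart (A ℤ.^ m) (A ℤ.^ n)
  powers-apart {m} {n} m<6 n<6 m≢n with ℕP.<-cmp m n
  ... | tri< m<n _ _ = apart-sym (powers-apart< m<n n<6)
  ... | tri≈ _ m≡n _ = contradiction m≡n m≢n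
  ... | tri> _ _ n<m = powers-apart< n<m m<6

  powers-all-apart : ∀ {es} → All (_< 6) es → Unique es → AllPairs Apart (map (A ℤ.^_) es)
  powers-all-apart All.[]             AllPairs.[]              = AllPairs.[]
  powers-all-apart (e<6 All.∷ es<6) (e∉es AllPairs.∷ unique) =
    All.map⁺ (All.zipWith (λ (e′<6 , e≢e′) → powers-apart e<6 e′<6 e≢e′) (es<6 , e∉es))
    AllPairs.∷ powers-all-apart es<6 unique

  roots : List ℤ
  roots = A ∷ - A ∷ A - + 1 ∷ - (A - + 1) ∷ + 1 ∷ - + 1 ∷ []

  exponents : List ℕ
  exponents = 1 ∷ 4 ∷ 2 ∷ 5 ∷ 0 ∷ 3 ∷ []

  roots≋powers : Pointwise _≋_ roots (map (A ℤ.^_) exponents)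
  roots≋powers = ≋-sym A¹≋A Pointwise.∷ ≋-sym A⁴≋-A Pointwise.∷ ≋-sym A²≋A-1 Pointwise.∷
                 ≋-sym A⁵≋-[A-1] Pointwise.∷ ≋-refl Pointwise.∷ ≋-sym A³≋-1 Pointwise.∷ Pointwise.[]

  exponents<6 : All (_< 6) exponents
  exponents<6 = from-yes (All.all? (ℕ._<? 6) exponents)

  roots-apart : AllPairs Apart roots
  roots-apart = Pointwise.AllPairs-resp-Pointwise apart-resp (Pointwise.symmetric ≋-sym roots≋powers)
    (powers-all-apart exponents<6 (from-yes (DecUnique.unique? ℕP._≟_ exponents)))

  roots-distinct : DistinctMod M roots
  roots-distinct = AllPairs.map (λ {u} {v} u#v u≡v → apart⇒≉ u#v (mk≋ {u} {v} u≡v)) roots-apart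

  ∈-exponents : ∀ {k} → k < 6 → k ∈ exponents
  ∈-exponents {0} _ = there (there (there (there (here refl))))
  ∈-exponents {1} _ = here refl
  ∈-exponents {2} _ = there (there (here refl))
  ∈-exponents {3} _ = there (there (there (there (there (here refl)))))
  ∈-exponents {4} _ = there (here refl)
  ∈-exponents {5} _ = there (there (there (here refl)))
  ∈-exponents {suc (suc (suc (suc (suc (suc _)))))} (s≤s (s≤s (s≤s (s≤s (s≤s (s≤s ()))))))

  root⇒power : ∀ {h} → h ∈ roots → ∃[ k ] (k < 6 × h ≋ A ℤ.^ k)
  root⇒power {h} h∈roots = as-power (pointwise⇒⊆≋ roots≋powers h∈roots)
    where
    as-power : ∃[ y ] (y ∈ map (A ℤ.^_) exponents × h ≋ y) → ∃[ k ] (k < 6 × h ≋ A ℤ.^ k)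
    as-power (y , y∈ , h≋y) =
      let (k , k∈ , y≡A^k) = ∈-map⁻ (A ℤ.^_) y∈ in k , All.lookup exponents<6 k∈ , subst (h ≋_) y≡A^k h≋y

  power⇒root : ∀ n → ∃[ h ] (h ∈ roots × A ℤ.^ n ≋ h)
  power⇒root n =
    let (h , h∈roots , A^r≋h) = pointwise⇒⊆≋ (Pointwise.symmetric ≋-sym roots≋powers)
                                   (∈-map⁺ (A ℤ.^_) (∈-exponents (ℕDM.m%n<n n 6)))
    in h , h∈roots , ≋-trans (A^n≋A^[n%6] n) A^r≋h

  roots-subgroup : IsAutSubgroup M roots
  roots-subgroup = roots-distinct , 1∈roots , (λ h∈ → inverse (root⇒power h∈)) ,
                   (λ h∈ h′∈ → multiply (root⇒power h∈) (root⇒power h′∈))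
    where
    open ≋-Reasoning
    1∈roots : + 1 ∈ roots
    1∈roots = there (there (there (there (here refl))))

    inverse : ∀ {h} → ∃[ k ] (k < 6 × h ≋ A ℤ.^ k) → ∃[ u ] (h * u ≡ + 1 [mod M ])
    inverse {h} (k , k<6 , h≋A^k) = A ℤ.^ (6 ℕ.∸ k) , unwrap (begin
      h * A ℤ.^ (6 ℕ.∸ k)          ≈⟨ *-congʳ (A ℤ.^ (6 ℕ.∸ k)) h≋A^k ⟩
      A ℤ.^ k * A ℤ.^ (6 ℕ.∸ k)    ≡⟨ ℤP.^-distribˡ-+-* A k (6 ℕ.∸ k) ⟨
      A ℤ.^ (k ℕ.+ (6 ℕ.∸ k))      ≡⟨ cong (A ℤ.^_) (ℕP.m+[n∸m]≡n (ℕP.<⇒≤ k<6)) ⟩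
      A ℤ.^ 6                      ≈⟨ A⁶≋1 ⟩
      + 1                          ∎)

    multiply : ∀ {h h′} → ∃[ k ] (k < 6 × h ≋ A ℤ.^ k) → ∃[ k ] (k < 6 × h′ ≋ A ℤ.^ k) →
              ∃[ h″ ] (h″ ∈ roots × h * h′ ≡ h″ [mod M ])
    multiply {h} {h′} (k , _ , h≋A^k) (l , _ , h′≋A^l) =
      let (h″ , h″∈roots , A^[k+l]≋h″) = power⇒root (k ℕ.+ l) in
      h″ , h″∈roots , unwrap (begin
        h * h′              ≈⟨ *-cong h≋A^k h′≋A^l ⟩
        A ℤ.^ k * A ℤ.^ l   ≡⟨ ℤP.^-distribˡ-+-* A k l ⟨
        A ℤ.^ (k ℕ.+ l)     ≈⟨ A^[k+l]≋h″ ⟩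
        h″                  ∎)

  -- only the identity x ↦ 1·x + 0 fixes two distinct points: for h = A^e
  -- with e ≠ 0, h - 1 is a unit, so h x + k ≡ x and h y + k ≡ y force
  -- x ≡ y; for h = 1 a fixed point forces k ≡ 0
  roots-frobenius : IsFrobenius M roots
  roots-frobenius = (A , here refl , λ A≡1 → apart⇒≉ A#1 (mk≋ {A} {+ 1} A≡1)) ,
                    (λ k x y h∈ fx fy x≉y → by-exponent k x y fx fy x≉y (root⇒power h∈))
    where
    A#1 : Apart A (+ 1)
    A#1 = apart (unit-resp (-‿cong A¹≋A (≋-refl {+ 1})) (A^d-1-unit (s≤s z≤n) (s≤s (s≤s z≤n))))

    by-exponent : ∀ {h} k x y → (h * x) + k ≡ x [mod M ] → (h * y) + k ≡ y [mod M ] →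
                  ¬ (x ≡ y [mod M ]) → ∃[ e ] (e < 6 × h ≋ A ℤ.^ e) →
                  (h ≡ + 1 [mod M ] × k ≡ + 0 [mod M ])
    by-exponent {h} k x y fx fy x≉y (zero , _ , h≋1) =
      unwrap h≋1 ,
      unwrap {k} {+ 0} (combine (+ 1) (- x) (diff≋0 (mk≋ {h * x + k} {x} fx)) (diff≋0 h≋1) translation)
      where
      translation : k - + 0 ≡ + 1 * (h * x + k - x) + - x * (h - + 1)
      translation = solve (h ∷ k ∷ x ∷ [])
    by-exponent {h} k x y fx fy x≉y (suc e , e<6 , h≋A^e) =
      contradiction (unwrap (diff≋0⁻¹ {x} {y} (unit⇒cancellable h-1-unit (combine (+ 1) (- + 1)
        (diff≋0 (mk≋ {h * x + k} {x} fx)) (diff≋0 (mk≋ {h * y + k} {y} fy)) difference)))) x≉y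
      where
      h-1-unit : Unit (h - + 1)
      h-1-unit = unit-resp (-‿cong (≋-sym h≋A^e) (≋-refl {+ 1})) (A^d-1-unit (s≤s z≤n) e<6)
      difference : (h - + 1) * (x - y) - + 0 ≡ + 1 * (h * x + k - x) + - + 1 * (h * y + k - y)
      difference = solve (h ∷ k ∷ x ∷ y ∷ [])

  x⁶-1≋∏ : ∀ x → x ℤ.^ 6 - + 1 ≋ prod (map (λ r → x - r) roots)
  x⁶-1≋∏ x = ≋-by cofactor Φ identity
    where
    cofactor : ℤ
    cofactor = - + 1 - A + A * A - x * x + x * x * A - x * x * A * A + + 2 * (x * x * x * x)
    identity : x * (x * (x * (x * (x * (x * + 1))))) - + 1
               - (x - A) * ((x - - A) * ((x - (A - + 1)) * ((x - - (A - + 1)) * ((x - + 1) * ((x - - + 1) * + 1)))))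
             ≡ (- + 1 - A + A * A - x * x + x * x * A - x * x * A * A + + 2 * (x * x * x * x)) * (A * A - A + + 1)
    identity = solve (x ∷ A ∷ [])

  -- the six numbers A, A - 1, 1, M - A, M - (A - 1), M - 1 of the side
  -- condition TLValid are the powers A¹, A², A⁰, A⁴, A⁵, A³ modulo M
  tl-unique : Unique (A ∷ A - + 1 ∷ + 1 ∷ + M - A ∷ + M - (A - + 1) ∷ + M - + 1 ∷ [])
  tl-unique = AllPairs.map (λ u#v u≡v → apart⇒≉ u#v (≋-reflexive u≡v))
    (Pointwise.AllPairs-resp-Pointwise apart-resp (Pointwise.symmetric ≋-sym as-powers)
      (powers-all-apart (from-yes (All.all? (ℕ._<? 6) es)) (from-yes (DecUnique.unique? ℕP._≟_ es))))
    where
    es : List ℕ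
    es = 1 ∷ 2 ∷ 0 ∷ 4 ∷ 5 ∷ 3 ∷ []
    M-x≋-x : ∀ x → + M - x ≋ - x
    M-x≋-x x = ≋-by (+ 1) M≋0 (cancel (+ M) x)
      where
      cancel : ∀ m x → (m - x) - - x ≡ + 1 * m
      cancel = solve-∀
    as-powers : Pointwise _≋_ (A ∷ A - + 1 ∷ + 1 ∷ + M - A ∷ + M - (A - + 1) ∷ + M - + 1 ∷ [])
                              (map (A ℤ.^_) es)
    as-powers = ≋-sym A¹≋A Pointwise.∷ ≋-sym A²≋A-1 Pointwise.∷ ≋-refl Pointwise.∷
                ≋-trans (M-x≋-x A) (≋-sym A⁴≋-A) Pointwise.∷
                ≋-trans (M-x≋-x (A - + 1)) (≋-sym A⁵≋-[A-1]) Pointwise.∷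
                ≋-trans (M-x≋-x (+ 1)) (≋-sym A³≋-1) Pointwise.∷ Pointwise.[]

  tl-frobenius-circulant : FrobCirc6 M (TL M A (A - + 1) (+ 1))
  tl-frobenius-circulant =
    roots , + 1 , roots-subgroup , roots-frobenius ,
    generated-by-1 (there (there (there (there (here refl))))) , inj₁ (3 , refl) ,
    (λ x y → subst (λ S → Cay M roots x y ⇔ Cay M S x y) (sym roots·1≡roots) (mk⇔ id id)) ,
    cay-valent roots roots-distinct
    where
    roots·1≡roots : map (λ h → h * + 1) roots ≡ roots
    roots·1≡roots = trans (map-cong ℤP.*-identityʳ roots) (map-id roots)

module PrimePower (p : ℕ) (p-prime : Prime p) where
  open ModPrime p p-prime
  open Congruence p using () renaming (_≋_ to _≋ₚ_)
  open Residues p using (_≋?_)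

  coprime-cancellable : ∀ n {z} → ¬ (z ≋ₚ + 0) → Congruence.Cancellable (p ^ n) z
  coprime-cancellable zero    {z} _   {w} _      = Congruence.∣∣⇒≋0 1 (ℕD.1∣ _)
  coprime-cancellable (suc n) {z} z≉0 {w} zw≋0 = [ (λ z≋0 → contradiction z≋0 z≉0) , cancel-p ]′
      (euclid {z} {w} (≋-divisor (ℕD.m∣m*n (p ^ n)) zw≋0))
    where
    cancel-p : w ≋ₚ + 0 → w ≈ + 0 ⟨mod p ^ suc n ⟩
    cancel-p w≋0 = Congruence.∣∣⇒≋0 (p ^ suc n) (subst₂ ℤD._∣_ pⁿ·p≡pⁿ⁺¹ (sym w≡w′p)
                                     (ℤD.*-monoˡ-∣ (+ p) {+ (p ^ n)} {w′} w′≋0))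
      where
      w′ : ℤ
      w′ = Signed.quotient (Signed.∣ᵤ⇒∣ {+ p} {w} (Congruence.≋0⇒∣∣ p w≋0))
      w≡w′p : w ≡ w′ * + p
      w≡w′p = Signed._∣_.equality (Signed.∣ᵤ⇒∣ {+ p} {w} (Congruence.≋0⇒∣∣ p w≋0))
      pⁿ·p≡pⁿ⁺¹ : + (p ^ n) * + p ≡ + (p ^ suc n)
      pⁿ·p≡pⁿ⁺¹ = trans (sym (ℤP.pos-* (p ^ n) p)) (cong +_ (ℕP.*-comm (p ^ n) p))
      zw′p-divisible : + (p ^ n) * + p ℤD.∣ (z * w′) * + p
      zw′p-divisible = subst₂ ℤD._∣_ (sym pⁿ·p≡pⁿ⁺¹)
                              (trans (cong (z *_) w≡w′p) (sym (ℤP.*-assoc z w′ (+ p))))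
                              (Congruence.≋0⇒∣∣ (p ^ suc n) zw≋0)
      w′≋0 : + (p ^ n) ℤD.∣ w′
      w′≋0 = Congruence.≋0⇒∣∣ (p ^ n) (coprime-cancellable n z≉0
               (Congruence.∣∣⇒≋0 (p ^ n) (ℤD.*-cancelʳ-∣ (+ p) {+ (p ^ n)} {z * w′} zw′p-divisible)))

  1≉0-mod-pⁿ⁺¹ : ∀ n → ¬ (+ 1 ≈ + 0 ⟨mod p ^ suc n ⟩)
  1≉0-mod-pⁿ⁺¹ n 1≋0 = small≉0 (s≤s z≤n) 1<p (≋-divisor (ℕD.m∣m*n (p ^ n)) 1≋0)

  prod-coprime : ∀ {fs} → All (λ f → ¬ (f ≋ₚ + 0)) fs → ¬ (prod fs ≋ₚ + 0)
  prod-coprime All.[]             1≋0 = small≉0 (s≤s z≤n) 1<p 1≋0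
  prod-coprime {f ∷ fs} (f≉0 All.∷ fs≉0) ∏≋0 =
    [ f≉0 , prod-coprime fs≉0 ]′ (euclid {f} {prod fs} ∏≋0)

  divides-a-factor : ∀ n fs → AllPairs (λ f g → ¬ (f ≋ₚ + 0 × g ≋ₚ + 0)) fs →
                     prod fs ≈ + 0 ⟨mod p ^ suc n ⟩ → Any (λ f → f ≈ + 0 ⟨mod p ^ suc n ⟩) fs
  divides-a-factor n []       _                   1≋0 = contradiction 1≋0 (1≉0-mod-pⁿ⁺¹ n)
  divides-a-factor n (f ∷ fs) (f⊥fs AllPairs.∷ pairs) ∏≋0 = by-cases (f ≋? + 0)
    where
    by-cases : Dec (f ≋ₚ + 0) → Any (λ f → f ≈ + 0 ⟨mod p ^ suc n ⟩) (f ∷ fs)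
    by-cases (yes f≋0) = here (coprime-cancellable (suc n)
      (prod-coprime (All.map (λ ¬both g≋0 → ¬both (f≋0 , g≋0)) f⊥fs))
      (Congruence.≋-trans (p ^ suc n) (Congruence.≋-reflexive (p ^ suc n) (ℤP.*-comm (prod fs) f)) ∏≋0))
    by-cases (no f≉0)  = there (divides-a-factor n fs pairs (coprime-cancellable (suc n) f≉0 ∏≋0))

module Uniqueness (p : ℕ) (p-prime : Prime p) (n : ℕ) (A : ℤ)
                  (Φ : A * A - A + + 1 ≈ + 0 ⟨mod p ^ suc n ⟩)
                  (6-unit : Congruence.Unit (p ^ suc n) (+ 6)) where
  private
    N = p ^ suc n
    p∣N : p ℕD.∣ N
    p∣N = ℕD.m∣m*n (p ^ n)
    open ModPrime p p-prime using (p≢0; small≉0; 1<p)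

  instance
    N≢0 : NonZero N
    N≢0 = ℕP.m^n≢0 p (suc n)

  open PrimePower p p-prime
  open SixthRoots N A Φ 6-unit (1≉0-mod-pⁿ⁺¹ n)
  open Congruence N
  open Residues N
  open Lagrange N
  open Circulants N

  -- every sixth root of unity modulo N is one of the roots: the factors
  -- h - r of h⁶ - 1 are pairwise prime to p, since the roots are pairwise
  -- apart, so N divides one of them
  sixth-root⇒root : ∀ {h} → h ℤ.^ 6 ≋ + 1 → ∃[ r ] (r ∈ roots × h ≋ r)
  sixth-root⇒root {h} h⁶≋1 =
    let (r , r∈roots , h-r≋0) = find (AnyP.map⁻ {f = λ r → h - r}
                                  (divides-a-factor n (map (λ r → h - r) roots) coprime-factors ∏≋0))
    in r , r∈roots , diff≋0⁻¹ {h} {r} h-r≋0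
    where
    ∏≋0 : prod (map (λ r → h - r) roots) ≋ + 0
    ∏≋0 = ≋-trans (≋-sym (x⁶-1≋∏ h)) (diff≋0 h⁶≋1)
    coprime-factors : AllPairs (λ f g → ¬ (f ≈ + 0 ⟨mod p ⟩ × g ≈ + 0 ⟨mod p ⟩))
                               (map (λ r → h - r) roots)
    coprime-factors = AllPairs.map⁺ {f = λ r → h - r} (AllPairs.map (λ {r} {r′} r#r′ (h-r≋0 , h-r′≋0) →
      Congruence.unit≉0 p (small≉0 (s≤s z≤n) 1<p) (unit-divisor p∣N (Apart.difference-unit r#r′))
        (Congruence.combine p (- + 1) (+ 1) h-r≋0 h-r′≋0 (difference h r r′))) roots-apart)
      where
      difference : ∀ h r r′ → (r - r′) - + 0 ≡ - + 1 * (h - r) + + 1 * (h - r′)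
      difference = solve-∀

  module Circulant (Γ : Graph N) (H : List ℤ) (a : ℤ)
                   (distinct-H : DistinctMod N H)
                   (inverses : ∀ {h} → h ∈ H → ∃[ u ] (h * u ≡ + 1 [mod N ]))
                   (closed : ∀ {h h′} → h ∈ H → h′ ∈ H → ∃[ h″ ] (h″ ∈ H × h * h′ ≡ h″ [mod N ]))
                   (generates : ∀ x → Gen N (map (λ h → h * a) H) x)
                   (Γ⇔Cay : ∀ x y → Γ x y ⇔ Cay N (map (λ h → h * a) H) x y)
                   (valent : Valent 6 Γ) where
    open ≋-Reasoning
    S : List ℤ
    S = map (λ h → h * a) H

    private
      rotate : ∀ a t h → (a * t) * h ≡ t * (h * a)
      rotate = solve-∀
      swap-factors : ∀ t a y → t * (a * y) ≡ (a * t) * y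
      swap-factors = solve-∀
      factor-out : ∀ t x y → t * x - t * y ≡ t * (x - y)
      factor-out = solve-∀

    -- a^H generates ℤ_N, so 1 is a multiple of a: a is a unit, with inverse t
    t : ℤ
    t = proj₁ (generated-multiples (generates (+ 1)))
    1≋at : + 1 ≋ a * t
    1≋at = proj₂ (generated-multiples (generates (+ 1)))

    cancel-at : ∀ z → z ≋ (a * t) * z
    cancel-at z = ≋-trans (≋-reflexive (sym (ℤP.*-identityˡ z))) (*-congʳ z 1≋at)

    -- hence a^H has |H| distinct elements, and |H| = 6 is the valency of Γ
    distinct-S : DistinctMod N S
    distinct-S = AllPairs.map⁺ {f = λ h → h * a} (AllPairs.map (λ {h} {h′} h≉h′ ha≡h′a →
      h≉h′ (unwrap {h} {h′} (begin
        h                ≈⟨ cancel-at h ⟩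
        (a * t) * h      ≡⟨ rotate a t h ⟩
        t * (h * a)      ≈⟨ *-congˡ t (mk≋ {h * a} {h′ * a} ha≡h′a) ⟩
        t * (h′ * a)     ≡⟨ rotate a t h′ ⟨
        (a * t) * h′     ≈⟨ cancel-at h′ ⟨
        h′               ∎))) distinct-H)

    |H|≡6 : length H ≡ 6
    |H|≡6 = trans (sym (length-map (λ h → h * a) H))
                  (valency-unique (vertex (+ 0)) (cay-valent S distinct-S) valent
                                  (λ y → ⇔-sym (Γ⇔Cay (vertex (+ 0)) y)))

    unit-H : ∀ {h} → h ∈ H → Unit h
    unit-H h∈H = let (u , hu≡1) = inverses h∈H in unit u (mk≋ hu≡1)

    sixth-root : ∀ {h} → h ∈ H → h ℤ.^ 6 ≋ + 1
    sixth-root {h} h∈H = subst (λ k → h ℤ.^ k ≋ + 1) |H|≡6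
      (power-length≋1 distinct-H (All.tabulate (unit⇒cancellable ∘ unit-H)) (unit⇒cancellable (unit-H h∈H))
        (λ hh′∈ → let (h′ , h′∈H , hh′≡h′) = ∈-map⁻ (h *_) hh′∈ ; (h″ , h″∈H , hh′≡h″) = closed h∈H h′∈H in
                  h″ , h″∈H , subst (_≋ h″) (sym hh′≡h′) (mk≋ hh′≡h″)))

    -- H consists of sixth roots of unity, hence of roots, and by counting
    -- it contains all of them
    H⊆≋roots : H ⊆≋ roots
    H⊆≋roots h∈H = sixth-root⇒root (sixth-root h∈H)

    roots⊆≋H : roots ⊆≋ H
    roots⊆≋H = cover distinct-H (ℕP.≤-reflexive (sym |H|≡6)) H⊆≋roots

    -- the isomorphism is multiplication by t = a⁻¹
    scale unscale : Fin N → Fin N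
    scale x   = vertex (t * ι x)
    unscale y = vertex (a * ι y)

    scale∘unscale : ∀ y → scale (unscale y) ≡ y
    scale∘unscale y = ι-injective (begin
      ι (scale (unscale y))   ≈⟨ ι-vertex (t * ι (unscale y)) ⟩
      t * ι (unscale y)       ≈⟨ *-congˡ t (ι-vertex (a * ι y)) ⟩
      t * (a * ι y)           ≡⟨ swap-factors t a (ι y) ⟩
      (a * t) * ι y           ≈⟨ cancel-at (ι y) ⟨
      ι y                     ∎)

    unscale∘scale : ∀ x → unscale (scale x) ≡ x
    unscale∘scale x = ι-injective (begin
      ι (unscale (scale x))   ≈⟨ ι-vertex (a * ι (scale x)) ⟩
      a * ι (scale x)         ≈⟨ *-congˡ a (ι-vertex (t * ι x)) ⟩
      a * (t * ι x)           ≡⟨ ℤP.*-assoc a t (ι x) ⟨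
      (a * t) * ι x           ≈⟨ cancel-at (ι x) ⟨
      ι x                     ∎)

    scaled-difference : ∀ x y → ι (scale x) - ι (scale y) ≋ t * (ι x - ι y)
    scaled-difference x y = begin
      ι (scale x) - ι (scale y)   ≈⟨ -‿cong (ι-vertex (t * ι x)) (ι-vertex (t * ι y)) ⟩
      t * ι x - t * ι y           ≡⟨ factor-out t (ι x) (ι y) ⟩
      t * (ι x - ι y)             ∎

    adjacency : ∀ x y → Γ x y ⇔ TL N A (A - + 1) (+ 1) (scale x) (scale y)
    adjacency x y = mk⇔ (λ Γxy → forward (Equivalence.to (Γ⇔Cay x y) Γxy))
                        (λ TLxy → Equivalence.from (Γ⇔Cay x y) (backward TLxy))
      where
      forward : Cay N S x y → TL N A (A - + 1) (+ 1) (scale x) (scale y)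
      forward (s , s∈S , x-y≡s) =
        let (h , h∈H , s≡ha) = ∈-map⁻ (λ h → h * a) s∈S ; (r , r∈roots , h≋r) = H⊆≋roots h∈H in
        r , r∈roots , unwrap (begin
          ι (scale x) - ι (scale y)   ≈⟨ scaled-difference x y ⟩
          t * (ι x - ι y)             ≈⟨ *-congˡ t (mk≋ {ι x - ι y} {s} x-y≡s) ⟩
          t * s                       ≡⟨ cong (t *_) s≡ha ⟩
          t * (h * a)                 ≡⟨ rotate a t h ⟨
          (a * t) * h                 ≈⟨ cancel-at h ⟨
          h                           ≈⟨ h≋r ⟩
          r                           ∎)

      backward : TL N A (A - + 1) (+ 1) (scale x) (scale y) → Cay N S x y
      backward (r , r∈roots , fx-fy≡r) =
        let (h , h∈H , r≋h) = roots⊆≋H r∈roots in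
        h * a , ∈-map⁺ (λ h → h * a) h∈H , unwrap (begin
          ι x - ι y                           ≈⟨ cancel-at (ι x - ι y) ⟩
          (a * t) * (ι x - ι y)               ≡⟨ ℤP.*-assoc a t (ι x - ι y) ⟩
          a * (t * (ι x - ι y))               ≈⟨ *-congˡ a (scaled-difference x y) ⟨
          a * (ι (scale x) - ι (scale y))     ≈⟨ *-congˡ a (mk≋ {ι (scale x) - ι (scale y)} {r} fx-fy≡r) ⟩
          a * r                               ≈⟨ *-congˡ a r≋h ⟩
          a * h                               ≡⟨ ℤP.*-comm a h ⟩
          h * a                               ∎)

  uniqueness : (Γ : Graph N) → FrobCirc6 N Γ → Γ ≅ TL N A (A - + 1) (+ 1)
  uniqueness Γ (H , a , (distinct-H , _ , inverses , closed) , _ , generates , _ , Γ⇔Cay , valent) =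
    mk↔ₛ′ scale unscale scale∘unscale unscale∘scale , adjacency
    where open Circulant Γ H a distinct-H inverses closed generates Γ⇔Cay valent

prime≡1-mod-6 : ∀ {p} → Prime p → p % 6 ≡ 1 → ∃[ k ] (p ≡ suc (6 ℕ.* suc k))
prime≡1-mod-6 {p} p-prime p%6≡1 = from-quotient (p ℕ./ 6) (ℕDM.m≡m%n+[m/n]*n p 6)
  where
  from-quotient : ∀ q → p ≡ p % 6 ℕ.+ q ℕ.* 6 → ∃[ k ] (p ≡ suc (6 ℕ.* suc k))
  from-quotient zero    p≡ = contradiction (trans p≡ (cong (ℕ._+ 0) p%6≡1))
                                           (ℕ.nonTrivial⇒≢1 {{prime⇒nonTrivial p-prime}})
  from-quotient (suc k) p≡ =
    k , trans p≡ (trans (cong (ℕ._+ suc k ℕ.* 6) p%6≡1) (cong suc (ℕP.*-comm (suc k) 6)))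

pow≡1-mod-6 : ∀ {x} q n → x ≡ suc (6 ℕ.* q) → ∃[ r ] (x ^ n ≡ suc (6 ℕ.* r))
pow≡1-mod-6 q zero    x≡ = 0 , refl
pow≡1-mod-6 {x} q (suc n) x≡ =
  let (r , xⁿ≡) = pow≡1-mod-6 q n x≡ in
  q ℕ.+ r ℕ.+ 6 ℕ.* q ℕ.* r , trans (cong₂ ℕ._*_ x≡ xⁿ≡) (multiply q r)
  where
  multiply : ∀ a b → suc (6 ℕ.* a) ℕ.* suc (6 ℕ.* b) ≡ suc (6 ℕ.* (a ℕ.+ b ℕ.+ 6 ℕ.* a ℕ.* b))
  multiply = ℕ-solve-∀

6-unit : ∀ {N r} → N ≡ suc (6 ℕ.* r) → Congruence.Unit N (+ 6)
6-unit {N} {r} N≡ = Congruence.unit (- + r) (Congruence.≋-by N (- + 1) (Congruence.M≋0 N) identity)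
  where
  +N≡ : + N ≡ + 1 + + 6 * + r
  +N≡ = trans (cong +_ N≡) (trans (ℤP.pos-+ 1 (6 ℕ.* r)) (cong (λ z → + 1 + z) (ℤP.pos-* 6 r)))
  rearrange : ∀ r → + 6 * - r - + 1 ≡ - + 1 * (+ 1 + + 6 * r)
  rearrange = solve-∀
  identity : + 6 * - + r - + 1 ≡ - + 1 * + N
  identity = trans (rearrange (+ r)) (cong (- + 1 *_) (sym +N≡))

half : ∀ {N} m v → N ≡ suc (2 ℕ.* m) → ⌊ (N ℕ.+ 1) ℕ.* (v ℕ.+ 1) /2⌋ ≡ (m ℕ.+ 1) ℕ.* (v ℕ.+ 1)
half m v refl = trans (cong ⌊_/2⌋ (double m v)) (sym (ℕP.n≡⌊n+n/2⌋ _))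
  where
  double : ∀ m v → (suc (2 ℕ.* m) ℕ.+ 1) ℕ.* (v ℕ.+ 1) ≡
                   (m ℕ.+ 1) ℕ.* (v ℕ.+ 1) ℕ.+ (m ℕ.+ 1) ℕ.* (v ℕ.+ 1)
  double = ℕ-solve-∀

-- For odd N = 2m + 1 with 4 invertible, v² ≡ -3 and a ≡ ⌊(N + 1)(v + 1)/2⌋,
-- a is a root of x² - x + 1: a ≡ B = (m + 1)(v + 1) and 2B - 1 ≡ v, so
-- 4(B² - B + 1) = (2B - 1)² + 3 ≡ 0.
halving-root : ∀ {N} m v a → N ≡ suc (2 ℕ.* m) → Congruence.Unit N (+ 4) →
               (+ v) * (+ v) ≈ - (+ 3) ⟨mod N ⟩ →
               (+ a) ≈ (+ ⌊ (N ℕ.+ 1) ℕ.* (v ℕ.+ 1) /2⌋) ⟨mod N ⟩ →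
               + a * + a - + a + + 1 ≈ + 0 ⟨mod N ⟩
halving-root {N} m v a N≡ 4-unit v²≋-3 a≋half =
  ≋-trans (+-cong (-‿cong (*-cong a≋B a≋B) a≋B) (≋-refl {+ 1})) B-root
  where
  open Congruence N
  B : ℤ
  B = (+ m + + 1) * (+ v + + 1)

  a≋B : + a ≋ B
  a≋B = ≋-trans a≋half (≋-reflexive (trans (cong +_ (half m v N≡))
          (trans (ℤP.pos-* (m ℕ.+ 1) (v ℕ.+ 1)) (cong₂ _*_ (ℤP.pos-+ m 1) (ℤP.pos-+ v 1)))))

  +N≡ : + N ≡ + 1 + + 2 * + m
  +N≡ = trans (cong +_ N≡) (trans (ℤP.pos-+ 1 (2 ℕ.* m)) (cong (λ z → + 1 + z) (ℤP.pos-* 2 m)))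

  expand : ∀ m v → let B = (m + + 1) * (v + + 1) ; n = + 1 + + 2 * m in
           + 4 * (B * B - B + + 1) - + 0 ≡ + 1 * (v * v - - + 3) + ((v + + 1) * (n * (v + + 1) + + 2 * v)) * n
  expand = solve-∀

  identity : + 4 * (B * B - B + + 1) - + 0 ≡
             + 1 * (+ v * + v - - + 3) + ((+ v + + 1) * (+ N * (+ v + + 1) + + 2 * + v)) * + N
  identity = subst (λ n → + 4 * (B * B - B + + 1) - + 0 ≡
                          + 1 * (+ v * + v - - + 3) + ((+ v + + 1) * (n * (+ v + + 1) + + 2 * + v)) * n)
                   (sym +N≡) (expand (+ m) (+ v))

  B-root : B * B - B + + 1 ≋ + 0
  B-root = unit⇒cancellable 4-unit (combine (+ 1) ((+ v + + 1) * (+ N * (+ v + + 1) + + 2 * + v))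
                                             (diff≋0 v²≋-3) M≋0 identity)

in-range : ∀ {m N} → 0 < m → m < N → (+ 1 ℤ.≤ + m) × (+ m ℤ.≤ + N - + 1)
in-range {N = suc N} 0<m (s≤s m≤N) = ℤ.+≤+ 0<m , ℤ.+≤+ m≤N

tl-bounds : ∀ {N} a → a < N → 1 < N → ¬ (+ 1 ≈ + 0 ⟨mod N ⟩) →
            + a * + a - + a + + 1 ≈ + 0 ⟨mod N ⟩ →
            ((+ 1 ℤ.≤ + a) × (+ a ℤ.≤ + N - + 1)) × ((+ 1 ℤ.≤ + a - + 1) × (+ a - + 1 ℤ.≤ + N - + 1))
            × ((+ 1 ℤ.≤ + 1) × (+ 1 ℤ.≤ + N - + 1))
tl-bounds zero          _   _   1≉0 Φ≋0 = contradiction Φ≋0 1≉0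
tl-bounds (suc zero)    _   _   1≉0 Φ≋0 = contradiction Φ≋0 1≉0
tl-bounds (suc (suc b)) a<N 1<N _   _   =
  in-range (s≤s z≤n) a<N , in-range (s≤s z≤n) (ℕP.<-trans (ℕP.n<1+n _) a<N) , in-range (s≤s z≤n) 1<N

module PrimePowerModulus (p : ℕ) (p-prime : Prime p) (k : ℕ) (p≡ : p ≡ suc (6 ℕ.* suc k)) (n : ℕ) where
  open ModPrime p p-prime using (p≢0; 1<p)
  open PrimePower p p-prime using (1≉0-mod-pⁿ⁺¹)

  N : ℕ
  N = p ^ suc n

  instance
    N≢0 : NonZero N
    N≢0 = ℕP.m^n≢0 p (suc n)

  open Congruence N
  open Residues N using (res; res≋)

  1<N : 1 < N
  1<N = ℕP.<-≤-trans 1<p (ℕP.m≤m*n p (p ^ n) {{ℕP.m^n≢0 p n}})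

  r : ℕ
  r = proj₁ (pow≡1-mod-6 (suc k) (suc n) p≡)

  N≡6r+1 : N ≡ suc (6 ℕ.* r)
  N≡6r+1 = proj₂ (pow≡1-mod-6 (suc k) (suc n) p≡)

  6-invertible : Unit (+ 6)
  6-invertible = 6-unit {N} {r} N≡6r+1

  square-root : ∃[ v ] ((+ v) * (+ v) ≡ - (+ 3) [mod N ])
  square-root = let (w , w²≋-3) = sqrt-minus-3 p p-prime k p≡ n in
                res w , unwrap (≋-trans (*-cong (res≋ w) (res≋ w)) w²≋-3)

  classification : (v a : ℕ) → (+ v) * (+ v) ≡ - (+ 3) [mod N ] → a < N →
    (+ a) ≡ (+ ⌊ (N Data.Nat.+ 1) Data.Nat.* (v Data.Nat.+ 1) /2⌋) [mod N ] →
    TLValid N (+ a) ((+ a) - (+ 1)) (+ 1)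
    × FrobCirc6 N (TL N (+ a) ((+ a) - (+ 1)) (+ 1))
    × ((Γ : Graph N) → FrobCirc6 N Γ → Γ ≅ TL N (+ a) ((+ a) - (+ 1)) (+ 1))
  classification v a v²≡-3 a<N a≡half =
    (tl-bounds a a<N 1<N (1≉0-mod-pⁿ⁺¹ n) Φ , tl-unique) , tl-frobenius-circulant , uniqueness
    where
    Φ : + a * + a - + a + + 1 ≋ + 0
    Φ = halving-root (3 ℕ.* r) v a (trans N≡6r+1 (cong suc (ℕP.*-assoc 2 3 r)))
                     (6-unit⇒4-unit 6-invertible) (mk≋ v²≡-3) (mk≋ a≡half)
    open SixthRoots N (+ a) Φ 6-invertible (1≉0-mod-pⁿ⁺¹ n)
    open Uniqueness p p-prime n (+ a) Φ 6-invertible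

corollary2p3 : (p e : ℕ) → Prime p → p % 6 ≡ 1 → 1 ≤ e →
    (∃[ v ] ((+ v) * (+ v) ≡ - (+ 3) [mod p ^ e ]))
    × ((v a : ℕ) →
    (+ v) * (+ v) ≡ - (+ 3) [mod p ^ e ] →
    a < p ^ e →
    (+ a) ≡ (+ ⌊ (p ^ e Data.Nat.+ 1) Data.Nat.* (v Data.Nat.+ 1) /2⌋) [mod p ^ e ] →
    TLValid (p ^ e) (+ a) ((+ a) - (+ 1)) (+ 1)
    × FrobCirc6 (p ^ e) (TL (p ^ e) (+ a) ((+ a) - (+ 1)) (+ 1))
    × ((Γ : Graph (p ^ e)) → FrobCirc6 (p ^ e) Γ →
    Γ ≅ TL (p ^ e) (+ a) ((+ a) - (+ 1)) (+ 1)))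
corollary2p3 p (suc n) p-prime p%6≡1 (s≤s z≤n) =
  let (k , p≡) = prime≡1-mod-6 p-prime p%6≡1 in
  PrimePowerModulus.square-root p p-prime k p≡ n , PrimePowerModulus.classification p p-prime k p≡ n
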